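{- Let $G=\mathbb{Z}^k\oplus\mathbb{Z}/\mu_1\mathbb{Z}\oplus\dots\oplus\mathbb{Z}/\mu_r\mathbb{Z}$ with positive integers satisfying $\mu_r\mid\mu_{r-1}\mid\dots\mid\mu_1$, and write elements of $G$ as $(w,\eta)$ with $w=(w_1,\dots,w_k)\in\mathbb{Z}^k$ and $\eta=(\eta_1,\dots,\eta_r)$, $\eta_i\in\mathbb{Z}/\mu_i\mathbb{Z}$. Consider the following automorphisms of $G$, each of which changes only one coordinate and leaves all others unchanged: (1) for $1\le i\le k$, $\psi_i$ replaces $w_i$ by $-w_i$; (2) for $1\le i\le r$ and $u\in(\mathbb{Z}/\mu_i\mathbb{Z})^{\times}$, $\psi_{i,u}$ replaces $\eta_i$ by $u\eta_i$; (3) for $1\le i,j\le k$, $i\ne j$, $\alpha_{i,j}$ replaces $w_i$ by $w_i+w_j$; (4) for $1\le i\le r$, $1\le j\le k$, $\beta_{i,j}$ replaces $\eta_i$ by $\eta_i+ (w_j \bmod \mu_i)$; (5) for $1\le j<i\le r$, $\gamma_{i,j}$ replaces $\eta_i$ by $\eta_i+(\eta_j\bmod\mu_i)$ (well defined since $\mu_i\mid\mu_j$); (6) for $1\le i<j\le r$, $\delta_{i,j}$ replaces $\eta_i$ by $\eta_i+\frac{\mu_i}{\mu_j}\eta_j$ (well defined since $\mu_j\mid\mu_i$). Then the automorphism group $\mathrm{Aut}(G)$ is generated by all the $\psi_i,\psi_{i,u},\alpha_{i,j},\beta_{i,j},\gamma_{i,j},\delta_{i,j}$. -}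

module Defs where

open import Data.Nat as ℕ using (ℕ)
open import Data.Nat.Divisibility as ℕD using () renaming (_∣_ to _∣ℕ_)
open import Data.Integer using (ℤ; +_; _+_; _-_; _*_; -_; 1ℤ)
open import Data.Integer.Divisibility using (_∣_)
open import Data.Fin using (Fin; _≟_; _<_)
open import Data.Product using (_×_; _,_; Σ; proj₁; proj₂)
open import Relation.Nullary using (yes; no; ¬_)
open import Relation.Binary.PropositionalEquality using (_≡_; _≢_)
open import Function using (id; _∘_)

upd : {n : ℕ} → (Fin n → ℤ) → Fin n → ℤ → Fin n → ℤ
upd f i v j with j ≟ i
... | yes _ = v
... | no  _ = f j

IsUnitMod : ℕ → ℤ → Set
IsUnitMod m u = Σ ℤ λ v → (+ m) ∣ (u * v - 1ℤ)

module _ (k r : ℕ) (μ : Fin r → ℕ) where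

  -- G = ℤ^k ⊕ ⊕_i ℤ/μ_i ; an element (w , η), η_i represented by an integer
  G : Set
  G = (Fin k → ℤ) × (Fin r → ℤ)

  _≈_ : G → G → Set
  (w , η) ≈ (w' , η') = (∀ i → w i ≡ w' i) × (∀ i → (+ μ i) ∣ (η i - η' i))

  _⊕_ : G → G → G
  (w , η) ⊕ (w' , η') = (λ i → w i + w' i) , (λ i → η i + η' i)

  record IsAut (f : G → G) : Set where
    field
      resp : ∀ x y → x ≈ y → f x ≈ f y
      hom  : ∀ x y → f (x ⊕ y) ≈ (f x ⊕ f y)
      inj  : ∀ x y → f x ≈ f y → x ≈ y
      surj : ∀ y → Σ G λ x → f x ≈ y

  -- the listed generators (indices 0-based)
  data Gen : Set where
    ψ  : Fin k → Gen
    ψu : (i : Fin r) (u : ℤ) → IsUnitMod (μ i) u → Gen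
    α  : (i j : Fin k) → i ≢ j → Gen
    β  : Fin r → Fin k → Gen
    γ  : (i j : Fin r) → j < i → Gen
    -- the divisibility proof supplies the integer μ_i / μ_j as its quotient
    δ  : (i j : Fin r) → i < j → μ j ∣ℕ μ i → Gen

  act : Gen → G → G
  act (ψ i)        (w , η) = upd w i (- w i) , η
  act (ψu i u _)   (w , η) = w , upd η i (u * η i)
  act (α i j _)    (w , η) = upd w i (w i + w j) , η
  act (β i j)      (w , η) = w , upd η i (η i + w j)
  act (γ i j _)    (w , η) = w , upd η i (η i + η j)
  act (δ i j _ d)  (w , η) = w , upd η i (η i + (+ ℕD._∣_.quotient d) * η j)

  data Generated : (G → G) → Set where
    gen  : (g : Gen) → Generated (act g)
    idG  : Generated id
    comp : {f g : G → G} → Generated f → Generated g → Generated (f ∘ g)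
    inv  : {f g : G → G} → Generated f → (∀ x y → x ≈ y → g x ≈ g y)
         → (∀ x → g (f x) ≈ x) → (∀ x → f (g x) ≈ x) → Generated g
    ext  : {f g : G → G} → Generated f → (∀ x → f x ≈ g x) → Generated g

{-# OPTIONS --safe #-}
-- An
-- automorphism F is composed with generated automorphisms, like a matrix with column operations,
-- until it fixes e₁ … e_k, t₁ … t_r in turn; an automorphism fixing every basis vector is the
-- identity. For e_m, Euclid's algorithm with the α's clears the later free entries of F(e_m);
-- expanding the m-th coordinate of e_m = F⁻¹(F e_m), where earlier basis vectors are fixed by F⁻¹
-- and torsion vectors have no free part, shows that the pivot entry is ±1, and ψ_m makes it 1.
-- For t_m the same expansion only says that the pivot and the combination L of the other entries
-- weighted by F⁻¹ generate the unit ideal mod μ_m. Since ℤ/μ_m has stable range one, adding a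
-- multiple of L to the pivot (a product of β's, γ's and δ's, the δ's available because μᵢ kills
-- F⁻¹(tᵢ)) makes it a unit, which some ψ_{m,u} turns into 1. Finally the remaining entries of the
-- column are cleared by α, β, resp. γ, δ, the δ's now available because μ_m kills F(t_m).
module Submission where

open import Algebra.Bundles using (AbelianGroup)
open import Algebra.Structures using (IsAbelianGroup)
import Algebra.Properties.AbelianGroup as AbelianGroupProperties
import Algebra.Properties.Monoid.Sum as MonoidSum
import Algebra.Properties.Semiring.Sum as SemiringSum
open import Data.Empty using (⊥-elim)
open import Data.Fin as Fin using (Fin; toℕ; _≤_)
open import Data.Fin.Induction using (>-weakInduction)
import Data.Fin.Properties as Fin
open import Data.Integer as ℤ using (ℤ; +_; -[1+_]; 0ℤ; 1ℤ; -1ℤ; _+_; _-_; _*_; -_; ∣_∣)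
import Data.Integer.DivMod as ℤ
import Data.Integer.Divisibility as ℤᵘ
open import Data.Integer.Divisibility.Signed as ℤ∣ using (divides) renaming (_∣_ to _∣ℤ_)
import Data.Integer.Properties as ℤ
open import Data.Integer.Tactic.RingSolver using (solve-∀)
open import Data.Nat as ℕ using (ℕ; zero; suc; NonZero)
open import Data.Nat.Coprimality using (Coprime; coprime-divisor; coprime-Bézout; gcd≡1⇒coprime)
open import Data.Nat.Divisibility using (_∣_)
import Data.Nat.Divisibility as ℕ
open import Data.Nat.GCD using (gcd; gcd[m,n]∣m; gcd[m,n]∣n; gcd[m,n]≡0⇒m≡0; module Bézout)
open import Data.Nat.Induction using (<-rec)
import Data.Nat.Properties as ℕ
open import Data.Product using (Σ; ∃; ∃₂; _×_; _,_; proj₁; proj₂)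
open import Data.Sum using (_⊎_; inj₁; inj₂; [_,_]′)
import Data.Sum.Properties as Sum
open import Function using (_∘_; id)
open import Relation.Binary.Bundles using (Setoid)
open import Relation.Binary.Definitions using (tri<; tri≈; tri>)
open import Relation.Binary.PropositionalEquality
import Relation.Binary.Reasoning.Setoid as SetoidReasoning
open import Relation.Nullary using (Dec; yes; no; ¬_)
open import Relation.Nullary.Decidable using (toSum)

open import Defs using (G; _≈_; upd; IsAut; Generated; gen; idG; comp; inv; ext; ψ; ψu; α; β; γ; δ; act)

module ℤΣ = SemiringSum ℤ.+-*-semiring

infix 4 _≡_mod_
record _≡_mod_ (a b : ℤ) (m : ℕ) : Set where
  constructor mod-by
  field divides-difference : + m ∣ℤ a - b
open _≡_mod_ public

module _ {m : ℕ} where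

  ≡⇒≡-mod : ∀ {a b} → a ≡ b → a ≡ b mod m
  ≡⇒≡-mod {a} refl = mod-by (divides 0ℤ (ℤ.+-inverseʳ a))

  ≡-mod-refl : ∀ {a} → a ≡ a mod m
  ≡-mod-refl = ≡⇒≡-mod refl

  ≡-mod-sym : ∀ {a b} → a ≡ b mod m → b ≡ a mod m
  ≡-mod-sym {a} {b} (mod-by d) = mod-by (subst (+ m ∣ℤ_) (negate-difference a b) (ℤ∣.∣m⇒∣-m d))
    where
    negate-difference : ∀ a b → - (a - b) ≡ b - a
    negate-difference = solve-∀

  ≡-mod-trans : ∀ {a b c} → a ≡ b mod m → b ≡ c mod m → a ≡ c mod m
  ≡-mod-trans {a} {b} {c} (mod-by d) (mod-by e) =
    mod-by (subst (+ m ∣ℤ_) (telescope a b c) (ℤ∣.∣m∣n⇒∣m+n d e))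
    where
    telescope : ∀ a b c → (a - b) + (b - c) ≡ a - c
    telescope = solve-∀

  +-cong-mod : ∀ {a b c d} → a ≡ b mod m → c ≡ d mod m → a + c ≡ b + d mod m
  +-cong-mod {a} {b} {c} {d} (mod-by p) (mod-by q) =
    mod-by (subst (+ m ∣ℤ_) (interchange a b c d) (ℤ∣.∣m∣n⇒∣m+n p q))
    where
    interchange : ∀ a b c d → (a - b) + (c - d) ≡ (a + c) - (b + d)
    interchange = solve-∀

  *-congˡ-mod : ∀ c {a b} → a ≡ b mod m → c * a ≡ c * b mod m
  *-congˡ-mod c {a} {b} (mod-by p) =
    mod-by (subst (+ m ∣ℤ_) (distrib c a b) (ℤ∣.∣n⇒∣m*n c p))
    where
    distrib : ∀ c a b → c * (a - b) ≡ c * a - c * b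
    distrib = solve-∀

  *-congʳ-mod : ∀ c {a b} → a ≡ b mod m → a * c ≡ b * c mod m
  *-congʳ-mod c {a} {b} eq = subst₂ (_≡_mod m) (ℤ.*-comm c a) (ℤ.*-comm c b) (*-congˡ-mod c eq)

  -‿cong-mod : ∀ {a b} → a ≡ b mod m → - a ≡ - b mod m
  -‿cong-mod {a} {b} eq = subst₂ (_≡_mod m) (ℤ.-1*i≡-i a) (ℤ.-1*i≡-i b) (*-congˡ-mod -1ℤ eq)

  multiple≡0-mod : ∀ s → + m * s ≡ 0ℤ mod m
  multiple≡0-mod s = mod-by (divides s (trans (ℤ.+-identityʳ (+ m * s)) (ℤ.*-comm (+ m) s)))

≡-mod-setoid : ℕ → Setoid _ _
≡-mod-setoid m = record
  { Carrier = ℤ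
  ; _≈_ = λ a b → a ≡ b mod m
  ; isEquivalence = record { refl = ≡-mod-refl ; sym = ≡-mod-sym ; trans = ≡-mod-trans } }

mod-0⇒≡ : ∀ {a b} → a ≡ b mod 0 → a ≡ b
mod-0⇒≡ {a} {b} (mod-by d) = ℤ.i-j≡0⇒i≡j a b (ℤ∣.0∣⇒≡0 d)

≡-mod-∣ : ∀ {m n a b} → n ℕ.∣ m → a ≡ b mod m → a ≡ b mod n
≡-mod-∣ {m} {n} n∣m (mod-by d) = mod-by (ℤ∣.∣-trans (ℤ∣.∣ᵤ⇒∣ {+ n} {+ m} n∣m) d)

*-mod-* : ∀ q {m a b} → a ≡ b mod m → + q * a ≡ + q * b mod (q ℕ.* m)
*-mod-* q {m} {a} {b} (mod-by d) =
  mod-by (subst₂ _∣ℤ_ (sym (ℤ.pos-* q m)) (distrib (+ q) a b) (ℤ∣.*-monoʳ-∣ (+ q) d))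
  where
  distrib : ∀ c a b → c * (a - b) ≡ c * a - c * b
  distrib = solve-∀

n*z≡0-mod-q*n⇒q∣z : ∀ q n .{{_ : NonZero n}} {z} → + n * z ≡ 0ℤ mod (q ℕ.* n) → + q ∣ℤ z
n*z≡0-mod-q*n⇒q∣z q n {z} (mod-by qn∣nz) =
  ℤ∣.*-cancelʳ-∣ (+ n) (subst₂ _∣ℤ_ (ℤ.pos-* q n) (trans (ℤ.+-identityʳ (+ n * z)) (ℤ.*-comm (+ n) z)) qn∣nz)

≡-mod⇒∣ᵘ : ∀ {m a b} → a ≡ b mod m → + m ℤᵘ.∣ a - b
≡-mod⇒∣ᵘ (mod-by d) = ℤ∣.∣⇒∣ᵤ d

∣ᵘ⇒≡-mod : ∀ {m a b} → + m ℤᵘ.∣ a - b → a ≡ b mod m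
∣ᵘ⇒≡-mod d = mod-by (ℤ∣.∣ᵤ⇒∣ d)

i*j≡1⇒i≡1∨i≡-1 : ∀ i j → i * j ≡ 1ℤ → i ≡ 1ℤ ⊎ i ≡ -1ℤ
i*j≡1⇒i≡1∨i≡-1 i j ij≡1 =
  ∣i∣≡1⇒ i (ℕ.m*n≡1⇒m≡1 ∣ i ∣ ∣ j ∣ (trans (sym (ℤ.abs-* i j)) (cong ∣_∣ ij≡1)))
  where
  ∣i∣≡1⇒ : ∀ i → ∣ i ∣ ≡ 1 → i ≡ 1ℤ ⊎ i ≡ -1ℤ
  ∣i∣≡1⇒ (+ .1)           refl = inj₁ refl
  ∣i∣≡1⇒ -[1+ zero ]      _    = inj₂ refl
  ∣i∣≡1⇒ -[1+ suc _ ]     ()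

coprime-* : ∀ {d m n} → Coprime d m → Coprime d n → Coprime d (m ℕ.* n)
coprime-* d⊥m d⊥n (e∣d , e∣mn) =
  d⊥n (e∣d , coprime-divisor (λ (f∣e , f∣m) → d⊥m (ℕ.∣-trans f∣e e∣d , f∣m)) e∣mn)

-- Divide c by gcd(c, A) until that gcd is 1.
coprimePart : ∀ A c → c ≢ 0 →
              ∃ λ c′ → Coprime c′ A × (∀ {d} → Coprime d A → Coprime d c′ → Coprime d c)
coprimePart A = <-rec P step
  where
  P : ℕ → Set
  P c = c ≢ 0 → ∃ λ c′ → Coprime c′ A × (∀ {d} → Coprime d A → Coprime d c′ → Coprime d c)
  step : ∀ c → (∀ {c″} → c″ ℕ.< c → P c″) → P c
  step c rec c≢0 with gcd c A ℕ.≟ 1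
  ... | yes g≡1 = c , gcd≡1⇒coprime g≡1 , λ _ d⊥c → d⊥c
  ... | no  g≢1 with gcd[m,n]∣m c A
  ...   | ℕ.divides q c≡qg =
    c′ , c′⊥A , λ d⊥A d⊥c′ → subst (Coprime _) (sym c≡qg) (coprime-* (lift d⊥A d⊥c′) (d⊥g d⊥A))
    where
    g = gcd c A
    q≢0 : q ≢ 0
    q≢0 refl = c≢0 c≡qg
    g≥2 : 1 ℕ.< g
    g≥2 = ℕ.≤∧≢⇒< (ℕ.n≢0⇒n>0 (c≢0 ∘ gcd[m,n]≡0⇒m≡0)) (g≢1 ∘ sym)
    q<c : q ℕ.< c
    q<c = subst (q ℕ.<_) (sym c≡qg) (ℕ.m<m*n q g {{ℕ.≢-nonZero q≢0}} g≥2)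
    d⊥g : ∀ {d} → Coprime d A → Coprime d g
    d⊥g d⊥A (e∣d , e∣g) = d⊥A (e∣d , ℕ.∣-trans e∣g (gcd[m,n]∣n c A))
    c′ = proj₁ (rec q<c q≢0)
    c′⊥A = proj₁ (proj₂ (rec q<c q≢0))
    lift = proj₂ (proj₂ (rec q<c q≢0))

pos-∣ : ∀ {m n} → m ℕ.∣ n → + m ∣ℤ + n
pos-∣ {m} {n} = ℤ∣.∣ᵤ⇒∣ {+ m} {+ n}

-- With c the part of M coprime to a, a prime factor of M dividing a does not divide c x (it would
-- divide a, x and M), and one not dividing a divides c; either way it does not divide a + c x.
coprime-shift : ∀ {M} → M ≢ 0 → ∀ a x → (∀ {e} → + e ∣ℤ a → + e ∣ℤ x → e ℕ.∣ M → e ≡ 1) →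
                ∃ λ c → Coprime ∣ a + + c * x ∣ M
coprime-shift {M} M≢0 a x noCommonDivisor = c , b⊥M
  where
  c = proj₁ (coprimePart ∣ a ∣ M M≢0)
  c⊥a = proj₁ (proj₂ (coprimePart ∣ a ∣ M M≢0))
  lift = proj₂ (proj₂ (coprimePart ∣ a ∣ M M≢0))
  b⊥M : Coprime ∣ a + + c * x ∣ M
  b⊥M {D} (D∣b , D∣M) = lift D⊥a D⊥c (ℕ.∣-refl , D∣M)
    where
    D∣b′ : + D ∣ℤ a + + c * x
    D∣b′ = ℤ∣.∣ᵤ⇒∣ D∣b
    D⊥c : Coprime D c
    D⊥c {e} (e∣D , e∣c) = c⊥a (e∣c , ℤ∣.∣⇒∣ᵤ e∣a)
      where
      e∣a : + e ∣ℤ a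
      e∣a = ℤ∣.∣m+n∣n⇒∣m (ℤ∣.∣-trans (pos-∣ e∣D) D∣b′) (ℤ∣.∣m⇒∣m*n x (pos-∣ e∣c))
    D⊥a : Coprime D ∣ a ∣
    D⊥a {e} (e∣D , e∣∣a∣) = noCommonDivisor e∣a (ℤ∣.∣ᵤ⇒∣ e∣x) (ℕ.∣-trans e∣D D∣M)
      where
      e∣a : + e ∣ℤ a
      e∣a = ℤ∣.∣ᵤ⇒∣ e∣∣a∣
      e∣cx : e ℕ.∣ c ℕ.* ∣ x ∣
      e∣cx = subst (e ℕ.∣_) (ℤ.abs-* (+ c) x)
               (ℤ∣.∣⇒∣ᵤ (ℤ∣.∣m+n∣m⇒∣n (ℤ∣.∣-trans (pos-∣ e∣D) D∣b′) e∣a))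
      e∣x : e ℕ.∣ ∣ x ∣
      e∣x = coprime-divisor (λ (f∣e , f∣c) → D⊥c (ℕ.∣-trans f∣e e∣D , f∣c)) e∣cx

coprime⇒invertible : ∀ {M} b → Coprime ∣ b ∣ M → ∃ λ u → b * u ≡ 1ℤ mod M
coprime⇒invertible {M} b b⊥M = signed b (natural-inverse ∣ b ∣ b⊥M)
  where
  open ≡-Reasoning
  pos-1+* : ∀ p q r s → 1 ℕ.+ p ℕ.* q ≡ r ℕ.* s → 1ℤ + + p * + q ≡ + r * + s
  pos-1+* p q r s eq = begin
    1ℤ + + p * + q      ≡⟨ cong (_+_ 1ℤ) (ℤ.pos-* p q) ⟨
    1ℤ + + (p ℕ.* q)    ≡⟨ ℤ.pos-+ 1 (p ℕ.* q) ⟨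
    + (1 ℕ.+ p ℕ.* q)   ≡⟨ cong +_ eq ⟩
    + (r ℕ.* s)         ≡⟨ ℤ.pos-* r s ⟩
    + r * + s           ∎
  natural-inverse : ∀ n → Coprime n M → ∃ λ u → + n * u ≡ 1ℤ mod M
  natural-inverse n n⊥M with coprime-Bézout n⊥M
  ... | Bézout.+- x y 1+yM≡xn = + x , mod-by (divides (+ y) (begin
    + n * + x - 1ℤ       ≡⟨ cong (_- 1ℤ) (ℤ.*-comm (+ n) (+ x)) ⟩
    + x * + n - 1ℤ       ≡⟨ cong (_- 1ℤ) (pos-1+* y M x n 1+yM≡xn) ⟨
    1ℤ + + y * + M - 1ℤ  ≡⟨ cancel (+ y * + M) ⟩
    + y * + M            ∎))
    where
    cancel : ∀ t → 1ℤ + t - 1ℤ ≡ t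
    cancel = solve-∀
  ... | Bézout.-+ x y 1+xn≡yM = - + x , mod-by (divides (- + y) (begin
    + n * - + x - 1ℤ     ≡⟨ rearrange (+ n) (+ x) ⟩
    - (1ℤ + + x * + n)   ≡⟨ cong -_ (pos-1+* x n y M 1+xn≡yM) ⟩
    - (+ y * + M)        ≡⟨ ℤ.neg-distribˡ-* (+ y) (+ M) ⟩
    - + y * + M          ∎))
    where
    rearrange : ∀ n x → n * - x - 1ℤ ≡ - (1ℤ + x * n)
    rearrange = solve-∀
  signed : ∀ b → (∃ λ u → + ∣ b ∣ * u ≡ 1ℤ mod M) → ∃ λ u → b * u ≡ 1ℤ mod M
  signed (+ n)     inverse       = inverse
  signed -[1+ n ] (u , nu≡1) = - u , subst (_≡ 1ℤ mod M) (sym (neg*neg (+ suc n) u)) nu≡1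
    where
    neg*neg : ∀ a b → - a * - b ≡ a * b
    neg*neg = solve-∀

stableRange : ∀ {M} → M ≢ 0 → ∀ a x s t → a * s + x * t ≡ 1ℤ mod M →
              ∃₂ λ c u → (a + c * x) * u ≡ 1ℤ mod M
stableRange M≢0 a x s t (mod-by M∣as+xt-1) =
  + c , coprime⇒invertible (a + + c * x) (proj₂ (coprime-shift M≢0 a x noCommonDivisor))
  where
  noCommonDivisor : ∀ {e} → + e ∣ℤ a → + e ∣ℤ x → e ℕ.∣ _ → e ≡ 1
  noCommonDivisor {e} e∣a e∣x e∣M = ℕ.∣1⇒≡1 (ℤ∣.∣⇒∣ᵤ e∣1)
    where
    difference : ∀ b → b - (b - 1ℤ) ≡ 1ℤ
    difference = solve-∀
    e∣1 : + e ∣ℤ 1ℤ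
    e∣1 = subst (+ e ∣ℤ_) (difference (a * s + x * t))
            (ℤ∣.∣m∣n⇒∣m-n (ℤ∣.∣m∣n⇒∣m+n (ℤ∣.∣m⇒∣m*n s e∣a) (ℤ∣.∣m⇒∣m*n t e∣x))
                          (ℤ∣.∣-trans (pos-∣ e∣M) M∣as+xt-1))
  c = proj₁ (coprime-shift M≢0 a x noCommonDivisor)

sum-cong-mod : ∀ {m n} {h h′ : Fin n → ℤ} → (∀ a → h a ≡ h′ a mod m) → ℤΣ.sum h ≡ ℤΣ.sum h′ mod m
sum-cong-mod {n = zero}  eq = ≡-mod-refl
sum-cong-mod {n = suc n} eq = +-cong-mod (eq Fin.zero) (sum-cong-mod (eq ∘ Fin.suc))

sum-split : ∀ {m n} (h h′ : Fin n → ℤ) p → (∀ a → a ≢ p → h a ≡ h′ a mod m) →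
            ℤΣ.sum h ≡ (h p - h′ p) + ℤΣ.sum h′ mod m
sum-split h h′ Fin.zero    eq = ≡-mod-trans
  (+-cong-mod (≡-mod-refl {a = h Fin.zero}) (sum-cong-mod (λ a → eq (Fin.suc a) λ ())))
  (≡⇒≡-mod (regroup (h Fin.zero) (h′ Fin.zero) (ℤΣ.sum (h′ ∘ Fin.suc))))
  where
  regroup : ∀ a b s → a + s ≡ (a - b) + (b + s)
  regroup = solve-∀
sum-split h h′ (Fin.suc p) eq = ≡-mod-trans
  (+-cong-mod (eq Fin.zero λ ())
              (sum-split (h ∘ Fin.suc) (h′ ∘ Fin.suc) p (λ a a≢p → eq (Fin.suc a) (a≢p ∘ Fin.suc-injective))))
  (≡⇒≡-mod (swap (h′ Fin.zero) (h (Fin.suc p) - h′ (Fin.suc p)) (ℤΣ.sum (h′ ∘ Fin.suc))))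
  where
  swap : ∀ a d s → a + (d + s) ≡ d + (a + s)
  swap = solve-∀

downward-induction : ∀ {ℓ} (P : ℕ → Set ℓ) n → P n → (∀ (p : Fin n) → P (suc (toℕ p)) → P (toℕ p)) → P 0
downward-induction P n Pn step =
  >-weakInduction (P ∘ toℕ) (subst P (sym (Fin.toℕ-fromℕ n)) Pn)
                  (λ p → subst P (sym (Fin.toℕ-inject₁ p)) ∘ step p) Fin.zero

module Group (k r : ℕ) (μ : Fin r → ℕ) where

  𝔾 : Set
  𝔾 = G k r μ

  Coord : Set
  Coord = Fin k ⊎ Fin r

  _≟_ : (i j : Coord) → Dec (i ≡ j)
  _≟_ = Sum.≡-dec Fin._≟_ Fin._≟_

  -- Free coordinates get modulus 0, for which congruence is equality.
  modulus : Coord → ℕ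
  modulus (inj₁ _) = 0
  modulus (inj₂ i) = μ i

  coord : Coord → 𝔾 → ℤ
  coord (inj₁ i) x = proj₁ x i
  coord (inj₂ i) x = proj₂ x i

  infix 4 _≋_
  record _≋_ (x y : 𝔾) : Set where
    constructor coordwise
    field at : ∀ j → coord j x ≡ coord j y mod modulus j
  open _≋_ public

  ≋⇒≈ : ∀ {x y} → x ≋ y → _≈_ k r μ x y
  ≋⇒≈ (coordwise p) = (λ i → mod-0⇒≡ (p (inj₁ i))) , (λ i → ≡-mod⇒∣ᵘ (p (inj₂ i)))

  ≈⇒≋ : ∀ {x y} → _≈_ k r μ x y → x ≋ y
  ≈⇒≋ {x} {y} (p , q) = coordwise at′
    where
    at′ : ∀ j → coord j x ≡ coord j y mod modulus j
    at′ (inj₁ i) = ≡⇒≡-mod (p i)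
    at′ (inj₂ i) = ∣ᵘ⇒≡-mod (q i)

  pointwise : ∀ {x y} → (∀ j → coord j x ≡ coord j y) → x ≋ y
  pointwise p = coordwise (λ j → ≡⇒≡-mod (p j))

  infixl 6 _⊕_
  infixl 7 _•_

  _⊕_ : 𝔾 → 𝔾 → 𝔾
  _⊕_ = Defs._⊕_ k r μ

  0𝔾 : 𝔾
  0𝔾 = (λ _ → 0ℤ) , (λ _ → 0ℤ)

  ⊖_ : 𝔾 → 𝔾
  ⊖ x = (λ i → - proj₁ x i) , (λ i → - proj₂ x i)

  _•_ : ℤ → 𝔾 → 𝔾
  c • x = (λ i → c * proj₁ x i) , (λ i → c * proj₂ x i)

  coord-⊕ : ∀ j x y → coord j (x ⊕ y) ≡ coord j x + coord j y
  coord-⊕ (inj₁ _) _ _ = refl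
  coord-⊕ (inj₂ _) _ _ = refl

  coord-0 : ∀ j → coord j 0𝔾 ≡ 0ℤ
  coord-0 (inj₁ _) = refl
  coord-0 (inj₂ _) = refl

  coord-⊖ : ∀ j x → coord j (⊖ x) ≡ - coord j x
  coord-⊖ (inj₁ _) _ = refl
  coord-⊖ (inj₂ _) _ = refl

  coord-• : ∀ j c x → coord j (c • x) ≡ c * coord j x
  coord-• (inj₁ _) _ _ = refl
  coord-• (inj₂ _) _ _ = refl

  componentwise : ∀ {x y} → (∀ i → proj₁ x i ≡ proj₁ y i) → (∀ i → proj₂ x i ≡ proj₂ y i) → x ≋ y
  componentwise {x} {y} p q = pointwise at′
    where
    at′ : ∀ j → coord j x ≡ coord j y
    at′ (inj₁ i) = p i
    at′ (inj₂ i) = q i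

  ≋-refl : ∀ {x} → x ≋ x
  ≋-refl = coordwise (λ _ → ≡-mod-refl)

  ≋-sym : ∀ {x y} → x ≋ y → y ≋ x
  ≋-sym p = coordwise (λ j → ≡-mod-sym (at p j))

  ≋-trans : ∀ {x y z} → x ≋ y → y ≋ z → x ≋ z
  ≋-trans p q = coordwise (λ j → ≡-mod-trans (at p j) (at q j))

  ⊕-cong : ∀ {x y u v} → x ≋ y → u ≋ v → x ⊕ u ≋ y ⊕ v
  ⊕-cong {x} {y} {u} {v} p q = coordwise λ j →
    subst₂ (_≡_mod modulus j) (sym (coord-⊕ j x u)) (sym (coord-⊕ j y v)) (+-cong-mod (at p j) (at q j))

  •-cong : ∀ c {x y} → x ≋ y → c • x ≋ c • y
  •-cong c {x} {y} p = coordwise λ j →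
    subst₂ (_≡_mod modulus j) (sym (coord-• j c x)) (sym (coord-• j c y)) (*-congˡ-mod c (at p j))

  -1•x≋⊖x : ∀ x → -1ℤ • x ≋ ⊖ x
  -1•x≋⊖x x = componentwise (λ i → ℤ.-1*i≡-i (proj₁ x i)) (λ i → ℤ.-1*i≡-i (proj₂ x i))

  zero• : ∀ x → + 0 • x ≋ 0𝔾
  zero• x = componentwise (λ i → ℤ.*-zeroˡ (proj₁ x i)) (λ i → ℤ.*-zeroˡ (proj₂ x i))

  suc• : ∀ n x → + suc n • x ≋ x ⊕ + n • x
  suc• n x = componentwise (λ i → unfold (+ n) (proj₁ x i)) (λ i → unfold (+ n) (proj₂ x i))
    where
    unfold : ∀ n a → (1ℤ + n) * a ≡ a + n * a
    unfold = solve-∀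

  neg• : ∀ n x → -[1+ n ] • x ≋ ⊖ (+ suc n • x)
  neg• n x = componentwise (λ i → sym (ℤ.neg-distribˡ-* (+ suc n) (proj₁ x i)))
                           (λ i → sym (ℤ.neg-distribˡ-* (+ suc n) (proj₂ x i)))

  𝔾-isAbelianGroup : IsAbelianGroup _≋_ _⊕_ 0𝔾 ⊖_
  𝔾-isAbelianGroup = record
    { isGroup = record
      { isMonoid = record
        { isSemigroup = record
          { isMagma = record
            { isEquivalence = record { refl = ≋-refl ; sym = ≋-sym ; trans = ≋-trans }
            ; ∙-cong = ⊕-cong }
          ; assoc = λ x y z → componentwise (λ i → ℤ.+-assoc (proj₁ x i) (proj₁ y i) (proj₁ z i))
                                             (λ i → ℤ.+-assoc (proj₂ x i) (proj₂ y i) (proj₂ z i)) }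
        ; identity = (λ x → componentwise (λ i → ℤ.+-identityˡ (proj₁ x i)) (λ i → ℤ.+-identityˡ (proj₂ x i)))
                   , (λ x → componentwise (λ i → ℤ.+-identityʳ (proj₁ x i)) (λ i → ℤ.+-identityʳ (proj₂ x i))) }
      ; inverse = (λ x → componentwise (λ i → ℤ.+-inverseˡ (proj₁ x i)) (λ i → ℤ.+-inverseˡ (proj₂ x i)))
                , (λ x → componentwise (λ i → ℤ.+-inverseʳ (proj₁ x i)) (λ i → ℤ.+-inverseʳ (proj₂ x i)))
      ; ⁻¹-cong = λ {x} {y} p → ≋-trans (≋-sym (-1•x≋⊖x x)) (≋-trans (•-cong -1ℤ p) (-1•x≋⊖x y)) }
    ; comm = λ x y → componentwise (λ i → ℤ.+-comm (proj₁ x i) (proj₁ y i)) (λ i → ℤ.+-comm (proj₂ x i) (proj₂ y i)) }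

  𝔾-abelianGroup : AbelianGroup _ _
  𝔾-abelianGroup = record { isAbelianGroup = 𝔾-isAbelianGroup }

  open AbelianGroup 𝔾-abelianGroup public using () renaming (setoid to 𝔾-setoid; monoid to 𝔾-monoid)
  open AbelianGroupProperties 𝔾-abelianGroup using (identityˡ-unique; inverseʳ-unique)
  module 𝔾Σ = MonoidSum 𝔾-monoid

  infix 9 _[_]≔_
  _[_]≔_ : 𝔾 → Coord → ℤ → 𝔾
  x [ inj₁ i ]≔ v = upd (proj₁ x) i v , proj₂ x
  x [ inj₂ i ]≔ v = proj₁ x , upd (proj₂ x) i v

  private
    upd-same : ∀ {n} (f : Fin n → ℤ) i v → upd f i v i ≡ v
    upd-same f i v with i Fin.≟ i
    ... | yes _   = refl
    ... | no  i≢i = ⊥-elim (i≢i refl)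

    upd-other : ∀ {n} (f : Fin n → ℤ) {i j} v → j ≢ i → upd f i v j ≡ f j
    upd-other f {i} {j} v j≢i with j Fin.≟ i
    ... | yes j≡i = ⊥-elim (j≢i j≡i)
    ... | no  _   = refl

  coord-≔-same : ∀ i x v → coord i (x [ i ]≔ v) ≡ v
  coord-≔-same (inj₁ i) x v = upd-same (proj₁ x) i v
  coord-≔-same (inj₂ i) x v = upd-same (proj₂ x) i v

  coord-≔-other : ∀ {i j} x v → j ≢ i → coord j (x [ i ]≔ v) ≡ coord j x
  coord-≔-other {inj₁ i} {inj₁ j} x v j≢i = upd-other (proj₁ x) v (j≢i ∘ cong inj₁)
  coord-≔-other {inj₁ i} {inj₂ j} x v j≢i = refl
  coord-≔-other {inj₂ i} {inj₁ j} x v j≢i = refl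
  coord-≔-other {inj₂ i} {inj₂ j} x v j≢i = upd-other (proj₂ x) v (j≢i ∘ cong inj₂)

  ≋-split : ∀ i {x y} → coord i x ≡ coord i y mod modulus i →
            (∀ j → j ≢ i → coord j x ≡ coord j y mod modulus j) → x ≋ y
  ≋-split i {x} {y} same other = coordwise at′
    where
    at′ : ∀ j → coord j x ≡ coord j y mod modulus j
    at′ j with j ≟ i
    ... | yes refl = same
    ... | no  j≢i  = other j j≢i

  basis : Coord → 𝔾
  basis j = 0𝔾 [ j ]≔ 1ℤ

  coord-basis-same : ∀ j → coord j (basis j) ≡ 1ℤ
  coord-basis-same j = coord-≔-same j 0𝔾 1ℤ

  coord-basis-other : ∀ {i j} → j ≢ i → coord j (basis i) ≡ 0ℤ
  coord-basis-other {i} {j} j≢i = trans (coord-≔-other 0𝔾 1ℤ j≢i) (coord-0 j)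

  ∑ : (Coord → 𝔾) → 𝔾
  ∑ h = 𝔾Σ.sum (h ∘ inj₁) ⊕ 𝔾Σ.sum (h ∘ inj₂)

  ∑ℤ : (Coord → ℤ) → ℤ
  ∑ℤ h = ℤΣ.sum (h ∘ inj₁) + ℤΣ.sum (h ∘ inj₂)

  coord-sum : ∀ j {n} (h : Fin n → 𝔾) → coord j (𝔾Σ.sum h) ≡ ℤΣ.sum (λ a → coord j (h a))
  coord-sum j {zero}  h = coord-0 j
  coord-sum j {suc n} h = trans (coord-⊕ j (h Fin.zero) _) (cong (_+_ (coord j (h Fin.zero))) (coord-sum j (h ∘ Fin.suc)))

  coord-∑ : ∀ j h → coord j (∑ h) ≡ ∑ℤ (λ i → coord j (h i))
  coord-∑ j h = trans (coord-⊕ j _ _) (cong₂ _+_ (coord-sum j (h ∘ inj₁)) (coord-sum j (h ∘ inj₂)))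

  ∑-cong : ∀ {h h′} → (∀ j → h j ≋ h′ j) → ∑ h ≋ ∑ h′
  ∑-cong eq = ⊕-cong (𝔾Σ.sum-cong-≋ (eq ∘ inj₁)) (𝔾Σ.sum-cong-≋ (eq ∘ inj₂))

  ∑ℤ-cong : ∀ {h h′} → (∀ j → h j ≡ h′ j) → ∑ℤ h ≡ ∑ℤ h′
  ∑ℤ-cong eq = cong₂ _+_ (ℤΣ.sum-cong-≗ (eq ∘ inj₁)) (ℤΣ.sum-cong-≗ (eq ∘ inj₂))

  ∑ℤ-split : ∀ {m} (h h′ : Coord → ℤ) c → (∀ j → j ≢ c → h j ≡ h′ j mod m) →
             ∑ℤ h ≡ (h c - h′ c) + ∑ℤ h′ mod m
  ∑ℤ-split h h′ (inj₁ p) eq = ≡-mod-trans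
    (+-cong-mod (sum-split (h ∘ inj₁) (h′ ∘ inj₁) p (λ a a≢p → eq (inj₁ a) (a≢p ∘ Sum.inj₁-injective)))
                (sum-cong-mod (λ a → eq (inj₂ a) λ ())))
    (≡⇒≡-mod (ℤ.+-assoc (h (inj₁ p) - h′ (inj₁ p)) (ℤΣ.sum (h′ ∘ inj₁)) (ℤΣ.sum (h′ ∘ inj₂))))
  ∑ℤ-split h h′ (inj₂ p) eq = ≡-mod-trans
    (+-cong-mod (sum-cong-mod (λ a → eq (inj₁ a) λ ()))
                (sum-split (h ∘ inj₂) (h′ ∘ inj₂) p (λ a a≢p → eq (inj₂ a) (a≢p ∘ Sum.inj₂-injective))))
    (≡⇒≡-mod (swap (ℤΣ.sum (h′ ∘ inj₁)) (h (inj₂ p) - h′ (inj₂ p)) (ℤΣ.sum (h′ ∘ inj₂))))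
    where
    swap : ∀ a d s → a + (d + s) ≡ d + (a + s)
    swap = solve-∀

  ∑ℤ-single : ∀ {m} (h : Coord → ℤ) c → (∀ j → j ≢ c → h j ≡ 0ℤ mod m) → ∑ℤ h ≡ h c mod m
  ∑ℤ-single h c eq = ≡-mod-trans (∑ℤ-split h (λ _ → 0ℤ) c eq) (≡⇒≡-mod (begin
    (h c - 0ℤ) + ∑ℤ (λ _ → 0ℤ)                            ≡⟨ cong₂ _+_ (ℤ.+-identityʳ (h c))
                                                                    (cong₂ _+_ (ℤΣ.sum-replicate-zero k) (ℤΣ.sum-replicate-zero r)) ⟩
    h c + 0ℤ                                               ≡⟨ ℤ.+-identityʳ (h c) ⟩
    h c                                                    ∎))
    where open ≡-Reasoning

  expansion : ∀ x → x ≋ ∑ (λ j → coord j x • basis j)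
  expansion x = coordwise (λ c → ≡-mod-sym (at′ c))
    where
    term : Coord → 𝔾
    term j = coord j x • basis j
    vanish : ∀ c j → j ≢ c → coord c (term j) ≡ 0ℤ
    vanish c j j≢c = begin
      coord c (term j)              ≡⟨ coord-• c (coord j x) (basis j) ⟩
      coord j x * coord c (basis j) ≡⟨ cong (coord j x *_) (coord-basis-other (j≢c ∘ sym)) ⟩
      coord j x * 0ℤ                ≡⟨ ℤ.*-zeroʳ (coord j x) ⟩
      0ℤ                            ∎
      where open ≡-Reasoning
    at′ : ∀ c → coord c (∑ term) ≡ coord c x mod modulus c
    at′ c = begin
      coord c (∑ term)                ≡⟨ coord-∑ c term ⟩
      ∑ℤ (λ j → coord c (term j))     ≈⟨ ∑ℤ-single _ c (λ j j≢c → ≡⇒≡-mod (vanish c j j≢c)) ⟩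
      coord c (term c)                ≡⟨ trans (coord-• c (coord c x) (basis c)) (cong (coord c x *_) (coord-basis-same c)) ⟩
      coord c x * 1ℤ                  ≡⟨ ℤ.*-identityʳ (coord c x) ⟩
      coord c x                       ∎
      where open SetoidReasoning (≡-mod-setoid (modulus c))

  torsion-basis : ∀ i → + μ i • basis (inj₂ i) ≋ 0𝔾
  torsion-basis i = ≋-split (inj₂ i) at-i (λ j j≢i → ≡⇒≡-mod (elsewhere j j≢i))
    where
    open ≡-Reasoning
    at-i : coord (inj₂ i) (+ μ i • basis (inj₂ i)) ≡ coord (inj₂ i) 0𝔾 mod μ i
    at-i = ≡-mod-trans (≡⇒≡-mod (begin
      coord (inj₂ i) (+ μ i • basis (inj₂ i))     ≡⟨ coord-• (inj₂ i) (+ μ i) (basis (inj₂ i)) ⟩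
      + μ i * coord (inj₂ i) (basis (inj₂ i))     ≡⟨ cong (+ μ i *_) (coord-basis-same (inj₂ i)) ⟩
      + μ i * 1ℤ                                   ∎)) (multiple≡0-mod 1ℤ)
    elsewhere : ∀ j → j ≢ inj₂ i → coord j (+ μ i • basis (inj₂ i)) ≡ coord j 0𝔾
    elsewhere j j≢i = begin
      coord j (+ μ i • basis (inj₂ i))     ≡⟨ coord-• j (+ μ i) (basis (inj₂ i)) ⟩
      + μ i * coord j (basis (inj₂ i))     ≡⟨ cong (+ μ i *_) (coord-basis-other j≢i) ⟩
      + μ i * 0ℤ                           ≡⟨ ℤ.*-zeroʳ (+ μ i) ⟩
      0ℤ                                   ≡⟨ coord-0 j ⟨
      coord j 0𝔾                           ∎

  coord-torsion : ∀ n {x} → + n • x ≋ 0𝔾 → ∀ j → + n * coord j x ≡ 0ℤ mod modulus j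
  coord-torsion n {x} nx≋0 j = subst₂ (_≡_mod modulus j) (coord-• j (+ n) x) (coord-0 j) (at nx≋0 j)

  torsion⇒free-coord≡0 : ∀ n .{{_ : NonZero n}} {x} → + n • x ≋ 0𝔾 → ∀ l → coord (inj₁ l) x ≡ 0ℤ
  torsion⇒free-coord≡0 n nx≋0 l =
    ℤ.*-cancelˡ-≡ (+ n) _ 0ℤ (trans (mod-0⇒≡ (coord-torsion n nx≋0 (inj₁ l))) (sym (ℤ.*-zeroʳ (+ n))))

  record IsHom (f : 𝔾 → 𝔾) : Set where
    field
      ≋-cong  : ∀ {x y} → x ≋ y → f x ≋ f y
      ⊕-homo : ∀ x y → f (x ⊕ y) ≋ f x ⊕ f y

  module _ {f : 𝔾 → 𝔾} (f-hom : IsHom f) where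
    open IsHom f-hom
    open SetoidReasoning 𝔾-setoid

    hom-0 : f 0𝔾 ≋ 0𝔾
    hom-0 = identityˡ-unique (f 0𝔾) (f 0𝔾) (begin
      f 0𝔾 ⊕ f 0𝔾    ≈⟨ ⊕-homo 0𝔾 0𝔾 ⟨
      f (0𝔾 ⊕ 0𝔾)    ≈⟨ ≋-cong (AbelianGroup.identityˡ 𝔾-abelianGroup 0𝔾) ⟩
      f 0𝔾           ∎)

    hom-⊖ : ∀ x → f (⊖ x) ≋ ⊖ f x
    hom-⊖ x = inverseʳ-unique (f x) (f (⊖ x)) (begin
      f x ⊕ f (⊖ x)  ≈⟨ ⊕-homo x (⊖ x) ⟨
      f (x ⊕ ⊖ x)    ≈⟨ ≋-cong (AbelianGroup.inverseʳ 𝔾-abelianGroup x) ⟩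
      f 0𝔾           ≈⟨ hom-0 ⟩
      0𝔾             ∎)

    hom-• : ∀ c x → f (c • x) ≋ c • f x
    hom-• (+ n)    x = hom-ℕ n
      where
      hom-ℕ : ∀ n → f (+ n • x) ≋ + n • f x
      hom-ℕ zero    = begin
        f (+ 0 • x)     ≈⟨ ≋-cong (zero• x) ⟩
        f 0𝔾            ≈⟨ hom-0 ⟩
        0𝔾              ≈⟨ zero• (f x) ⟨
        + 0 • f x       ∎
      hom-ℕ (suc n) = begin
        f (+ suc n • x)       ≈⟨ ≋-cong (suc• n x) ⟩
        f (x ⊕ + n • x)       ≈⟨ ⊕-homo x (+ n • x) ⟩
        f x ⊕ f (+ n • x)     ≈⟨ ⊕-cong (≋-refl {f x}) (hom-ℕ n) ⟩
        f x ⊕ + n • f x       ≈⟨ suc• n (f x) ⟨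
        + suc n • f x         ∎
    hom-• -[1+ n ] x = begin
      f (-[1+ n ] • x)          ≈⟨ ≋-cong (neg• n x) ⟩
      f (⊖ (+ suc n • x))       ≈⟨ hom-⊖ (+ suc n • x) ⟩
      ⊖ f (+ suc n • x)         ≈⟨ AbelianGroup.⁻¹-cong 𝔾-abelianGroup (hom-• (+ suc n) x) ⟩
      ⊖ (+ suc n • f x)         ≈⟨ neg• n (f x) ⟨
      -[1+ n ] • f x            ∎

    hom-∑ : ∀ h → f (∑ h) ≋ ∑ (f ∘ h)
    hom-∑ h = ≋-trans (⊕-homo (𝔾Σ.sum (h ∘ inj₁)) (𝔾Σ.sum (h ∘ inj₂)))
                      (⊕-cong (hom-sum (h ∘ inj₁)) (hom-sum (h ∘ inj₂)))
      where
      hom-sum : ∀ {n} (h : Fin n → 𝔾) → f (𝔾Σ.sum h) ≋ 𝔾Σ.sum (f ∘ h)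
      hom-sum {zero}  h = hom-0
      hom-sum {suc n} h = ≋-trans (⊕-homo (h Fin.zero) (𝔾Σ.sum (h ∘ Fin.suc)))
                                  (⊕-cong (≋-refl {f (h Fin.zero)}) (hom-sum (h ∘ Fin.suc)))

    hom-expansion : ∀ x → f x ≋ ∑ (λ j → coord j x • f (basis j))
    hom-expansion x = begin
      f x                                  ≈⟨ ≋-cong (expansion x) ⟩
      f (∑ (λ j → coord j x • basis j))    ≈⟨ hom-∑ (λ j → coord j x • basis j) ⟩
      ∑ (λ j → f (coord j x • basis j))    ≈⟨ ∑-cong (λ j → hom-• (coord j x) (basis j)) ⟩
      ∑ (λ j → coord j x • f (basis j))    ∎

    coord-hom : ∀ c x → coord c (f x) ≡ ∑ℤ (λ j → coord j x * coord c (f (basis j))) mod modulus c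
    coord-hom c x = ≡-mod-trans (at (hom-expansion x) c)
      (≡⇒≡-mod (trans (coord-∑ c (λ j → coord j x • f (basis j)))
                      (∑ℤ-cong (λ j → coord-• c (coord j x) (f (basis j))))))

    hom-torsion : ∀ i → + μ i • f (basis (inj₂ i)) ≋ 0𝔾
    hom-torsion i = begin
      + μ i • f (basis (inj₂ i))   ≈⟨ hom-• (+ μ i) (basis (inj₂ i)) ⟨
      f (+ μ i • basis (inj₂ i))   ≈⟨ ≋-cong (torsion-basis i) ⟩
      f 0𝔾                         ≈⟨ hom-0 ⟩
      0𝔾                           ∎

    hom-fixing-basis : (∀ j → f (basis j) ≋ basis j) → ∀ x → f x ≋ x
    hom-fixing-basis fixes x = begin
      f x                                ≈⟨ hom-expansion x ⟩
      ∑ (λ j → coord j x • f (basis j))  ≈⟨ ∑-cong (λ j → •-cong (coord j x) (fixes j)) ⟩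
      ∑ (λ j → coord j x • basis j)      ≈⟨ expansion x ⟨
      x                                  ∎

  record IsAutomorphism (f : 𝔾 → 𝔾) : Set where
    field
      isHom        : IsHom f
      inverse      : 𝔾 → 𝔾
      inverse-cong : ∀ {x y} → x ≋ y → inverse x ≋ inverse y
      inverseˡ     : ∀ x → inverse (f x) ≋ x
      inverseʳ     : ∀ x → f (inverse x) ≋ x
    open IsHom isHom public

  IsAut⇒IsAutomorphism : ∀ {f} → IsAut k r μ f → IsAutomorphism f
  IsAut⇒IsAutomorphism {f} f-aut = record
    { isHom        = record { ≋-cong = λ p → ≈⇒≋ (IsAut.resp f-aut _ _ (≋⇒≈ p))
                            ; ⊕-homo = λ x y → ≈⇒≋ (IsAut.hom f-aut x y) }
    ; inverse      = λ y → proj₁ (IsAut.surj f-aut y)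
    ; inverse-cong = λ {x} {y} p → injective (≋-trans (onto x) (≋-trans p (≋-sym (onto y))))
    ; inverseˡ     = λ x → injective (onto (f x))
    ; inverseʳ     = onto }
    where
    injective : ∀ {x y} → f x ≋ f y → x ≋ y
    injective {x} {y} p = ≈⇒≋ (IsAut.inj f-aut x y (≋⇒≈ p))
    onto : ∀ y → f (proj₁ (IsAut.surj f-aut y)) ≋ y
    onto y = ≈⇒≋ (proj₂ (IsAut.surj f-aut y))

  isAutomorphism-inverse : ∀ {f g} → IsAutomorphism f → (∀ {x y} → x ≋ y → g x ≋ g y) →
                           (∀ x → g (f x) ≋ x) → (∀ x → f (g x) ≋ x) → IsAutomorphism g
  isAutomorphism-inverse {f} {g} f-aut g-cong gf≋id fg≋id = record
    { isHom        = record { ≋-cong = g-cong ; ⊕-homo = g-homo }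
    ; inverse      = f
    ; inverse-cong = ≋-cong
    ; inverseˡ     = fg≋id
    ; inverseʳ     = gf≋id }
    where
    open IsAutomorphism f-aut
    open SetoidReasoning 𝔾-setoid
    g-homo : ∀ x y → g (x ⊕ y) ≋ g x ⊕ g y
    g-homo x y = begin
      g (x ⊕ y)                 ≈⟨ g-cong (⊕-cong (fg≋id x) (fg≋id y)) ⟨
      g (f (g x) ⊕ f (g y))     ≈⟨ g-cong (⊕-homo (g x) (g y)) ⟨
      g (f (g x ⊕ g y))         ≈⟨ gf≋id (g x ⊕ g y) ⟩
      g x ⊕ g y                 ∎

  inverse-isAutomorphism : ∀ {f} (f-aut : IsAutomorphism f) → IsAutomorphism (IsAutomorphism.inverse f-aut)
  inverse-isAutomorphism f-aut = isAutomorphism-inverse f-aut inverse-cong inverseˡ inverseʳ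
    where open IsAutomorphism f-aut

  id-isAutomorphism : IsAutomorphism id
  id-isAutomorphism = record
    { isHom = record { ≋-cong = id ; ⊕-homo = λ _ _ → ≋-refl }
    ; inverse = id ; inverse-cong = id ; inverseˡ = λ _ → ≋-refl ; inverseʳ = λ _ → ≋-refl }

  ∘-isAutomorphism : ∀ {f g} → IsAutomorphism f → IsAutomorphism g → IsAutomorphism (f ∘ g)
  ∘-isAutomorphism {f} {g} f-aut g-aut = record
    { isHom        = record { ≋-cong = F.≋-cong ∘ G.≋-cong
                            ; ⊕-homo = λ x y → ≋-trans (F.≋-cong (G.⊕-homo x y)) (F.⊕-homo (g x) (g y)) }
    ; inverse      = G.inverse ∘ F.inverse
    ; inverse-cong = G.inverse-cong ∘ F.inverse-cong
    ; inverseˡ     = λ x → ≋-trans (G.inverse-cong (F.inverseˡ (g x))) (G.inverseˡ x)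
    ; inverseʳ     = λ x → ≋-trans (F.≋-cong (G.inverseʳ (F.inverse x))) (F.inverseʳ x) }
    where
    module F = IsAutomorphism f-aut
    module G = IsAutomorphism g-aut

  ext-isAutomorphism : ∀ {f g} → IsAutomorphism f → (∀ x → f x ≋ g x) → IsAutomorphism g
  ext-isAutomorphism {f} {g} f-aut f≋g = record
    { isHom        = record { ≋-cong = λ {x} {y} p → ≋-trans (≋-sym (f≋g x)) (≋-trans (≋-cong p) (f≋g y))
                            ; ⊕-homo = λ x y → ≋-trans (≋-sym (f≋g (x ⊕ y)))
                                                       (≋-trans (⊕-homo x y) (⊕-cong (f≋g x) (f≋g y))) }
    ; inverse      = inverse
    ; inverse-cong = inverse-cong
    ; inverseˡ     = λ x → ≋-trans (inverse-cong (≋-sym (f≋g x))) (inverseˡ x)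
    ; inverseʳ     = λ x → ≋-trans (≋-sym (f≋g (inverse x))) (inverseʳ x) }
    where open IsAutomorphism f-aut

  ≔-cong : ∀ i {x y a b} → a ≡ b mod modulus i → (∀ j → j ≢ i → coord j x ≡ coord j y mod modulus j) →
           x [ i ]≔ a ≋ y [ i ]≔ b
  ≔-cong i {x} {y} {a} {b} a≡b others = ≋-split i
    (subst₂ (_≡_mod modulus i) (sym (coord-≔-same i x a)) (sym (coord-≔-same i y b)) a≡b)
    (λ j j≢i → subst₂ (_≡_mod modulus j) (sym (coord-≔-other x a j≢i)) (sym (coord-≔-other y b j≢i)) (others j j≢i))

  ≔-≡ : ∀ i x {a b} → a ≡ b → x [ i ]≔ a ≋ x [ i ]≔ b
  ≔-≡ i x a≡b = ≔-cong i (≡⇒≡-mod a≡b) (λ _ _ → ≡-mod-refl)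

  ≔-self : ∀ i {x v} → v ≡ coord i x mod modulus i → x [ i ]≔ v ≋ x
  ≔-self i {x} {v} v≡xᵢ = ≋-split i
    (subst (_≡ coord i x mod modulus i) (sym (coord-≔-same i x v)) v≡xᵢ)
    (λ j j≢i → ≡⇒≡-mod (coord-≔-other x v j≢i))

  record IsForm (i : Coord) (L : 𝔾 → ℤ) : Set where
    field
      form-cong : ∀ {x y} → x ≋ y → L x ≡ L y mod modulus i
      form-+    : ∀ x y → L (x ⊕ y) ≡ L x + L y
      form-≔    : ∀ x v → L (x [ i ]≔ v) ≡ L x
  open IsForm public

  rowOp : Coord → ℤ → (𝔾 → ℤ) → 𝔾 → 𝔾
  rowOp i s L x = x [ i ]≔ (s * coord i x + L x)

  module _ (i : Coord) where

    rowOp-cong : ∀ s {L} → IsForm i L → ∀ {x y} → x ≋ y → rowOp i s L x ≋ rowOp i s L y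
    rowOp-cong s L-form x≋y = ≔-cong i (+-cong-mod (*-congˡ-mod s (at x≋y i)) (form-cong L-form x≋y)) (λ j _ → at x≋y j)

    rowOp-homo : ∀ s {L} → IsForm i L → ∀ x y → rowOp i s L (x ⊕ y) ≋ rowOp i s L x ⊕ rowOp i s L y
    rowOp-homo s {L} L-form x y = ≋-split i (≡⇒≡-mod at-i) (λ j j≢i → ≡⇒≡-mod (elsewhere j j≢i))
      where
      open ≡-Reasoning
      rearrange : ∀ s a b l l′ → s * (a + b) + (l + l′) ≡ (s * a + l) + (s * b + l′)
      rearrange = solve-∀
      at-i : coord i (rowOp i s L (x ⊕ y)) ≡ coord i (rowOp i s L x ⊕ rowOp i s L y)
      at-i = begin
        coord i (rowOp i s L (x ⊕ y))                     ≡⟨ coord-≔-same i (x ⊕ y) _ ⟩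
        s * coord i (x ⊕ y) + L (x ⊕ y)
          ≡⟨ cong₂ (λ a l → s * a + l) (coord-⊕ i x y) (form-+ L-form x y) ⟩
        s * (coord i x + coord i y) + (L x + L y)         ≡⟨ rearrange s (coord i x) (coord i y) (L x) (L y) ⟩
        (s * coord i x + L x) + (s * coord i y + L y)     ≡⟨ cong₂ _+_ (coord-≔-same i x _) (coord-≔-same i y _) ⟨
        coord i (rowOp i s L x) + coord i (rowOp i s L y) ≡⟨ coord-⊕ i (rowOp i s L x) (rowOp i s L y) ⟨
        coord i (rowOp i s L x ⊕ rowOp i s L y)           ∎
      elsewhere : ∀ j → j ≢ i → coord j (rowOp i s L (x ⊕ y)) ≡ coord j (rowOp i s L x ⊕ rowOp i s L y)
      elsewhere j j≢i = begin
        coord j (rowOp i s L (x ⊕ y))                     ≡⟨ coord-≔-other (x ⊕ y) _ j≢i ⟩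
        coord j (x ⊕ y)                                   ≡⟨ coord-⊕ j x y ⟩
        coord j x + coord j y                             ≡⟨ cong₂ _+_ (coord-≔-other x _ j≢i) (coord-≔-other y _ j≢i) ⟨
        coord j (rowOp i s L x) + coord j (rowOp i s L y) ≡⟨ coord-⊕ j (rowOp i s L x) (rowOp i s L y) ⟨
        coord j (rowOp i s L x ⊕ rowOp i s L y)           ∎

    rowOp-∘ : ∀ s L s′ L′ → (∀ x v → L (x [ i ]≔ v) ≡ L x) → ∀ x →
              rowOp i s L (rowOp i s′ L′ x) ≋ rowOp i (s * s′) (λ y → s * L′ y + L y) x
    rowOp-∘ s L s′ L′ L-≔ x = ≔-cong i (≡⇒≡-mod at-i) (λ j j≢i → ≡⇒≡-mod (coord-≔-other x _ j≢i))
      where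
      open ≡-Reasoning
      rearrange : ∀ s s′ a l′ l → s * (s′ * a + l′) + l ≡ s * s′ * a + (s * l′ + l)
      rearrange = solve-∀
      at-i : s * coord i (rowOp i s′ L′ x) + L (rowOp i s′ L′ x) ≡ s * s′ * coord i x + (s * L′ x + L x)
      at-i = begin
        s * coord i (rowOp i s′ L′ x) + L (rowOp i s′ L′ x)
          ≡⟨ cong₂ (λ a l → s * a + l) (coord-≔-same i x _) (L-≔ x _) ⟩
        s * (s′ * coord i x + L′ x) + L x                     ≡⟨ rearrange s s′ (coord i x) (L′ x) (L x) ⟩
        s * s′ * coord i x + (s * L′ x + L x)                 ∎

    rowOp-ext : ∀ s {s′} L L′ → s ≡ s′ mod modulus i → (∀ x → L x ≡ L′ x mod modulus i) →
                ∀ x → rowOp i s L x ≋ rowOp i s′ L′ x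
    rowOp-ext s {s′} L L′ s≡s′ L≡L′ x =
      ≔-cong i (+-cong-mod (*-congʳ-mod (coord i x) s≡s′) (L≡L′ x)) (λ j _ → ≡-mod-refl)

    rowOp-fix : ∀ s L {x} → coord i x ≡ 0ℤ → L x ≡ 0ℤ mod modulus i → rowOp i s L x ≋ x
    rowOp-fix s L {x} xᵢ≡0 Lx≡0 = ≔-self i (begin
      s * coord i x + L x    ≈⟨ +-cong-mod (≡-mod-refl {a = s * coord i x}) Lx≡0 ⟩
      s * coord i x + 0ℤ     ≡⟨ cong (λ a → s * a + 0ℤ) xᵢ≡0 ⟩
      s * 0ℤ + 0ℤ            ≡⟨ cong (_+ 0ℤ) (ℤ.*-zeroʳ s) ⟩
      0ℤ                     ≡⟨ xᵢ≡0 ⟨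
      coord i x              ∎)
      where open SetoidReasoning (≡-mod-setoid (modulus i))

    rowOp-id : ∀ x → rowOp i 1ℤ (λ _ → 0ℤ) x ≋ x
    rowOp-id x = ≔-self i (≡⇒≡-mod (trans (ℤ.+-identityʳ (1ℤ * coord i x)) (ℤ.*-identityˡ (coord i x))))

    zero-isForm : IsForm i (λ _ → 0ℤ)
    zero-isForm = record { form-cong = λ _ → ≡-mod-refl ; form-+ = λ _ _ → refl ; form-≔ = λ _ _ → refl }

    +-isForm : ∀ {L L′} → IsForm i L → IsForm i L′ → IsForm i (λ x → L x + L′ x)
    +-isForm {L} {L′} L-form L′-form = record
      { form-cong = λ p → +-cong-mod (form-cong L-form p) (form-cong L′-form p)
      ; form-+    = λ x y → trans (cong₂ _+_ (form-+ L-form x y) (form-+ L′-form x y)) (interchange (L x) (L y) (L′ x) (L′ y))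
      ; form-≔    = λ x v → cong₂ _+_ (form-≔ L-form x v) (form-≔ L′-form x v) }
      where
      interchange : ∀ a b c d → (a + b) + (c + d) ≡ (a + c) + (b + d)
      interchange = solve-∀

    scaled-isForm : ∀ c {L} → IsForm i L → IsForm i (λ x → c * L x)
    scaled-isForm c {L} L-form = record
      { form-cong = λ p → *-congˡ-mod c (form-cong L-form p)
      ; form-+    = λ x y → trans (cong (c *_) (form-+ L-form x y)) (ℤ.*-distribˡ-+ c (L x) (L y))
      ; form-≔    = λ x v → cong (c *_) (form-≔ L-form x v) }

    coord-isForm : ∀ {j} → j ≢ i → modulus i ℕ.∣ modulus j → IsForm i (coord j)
    coord-isForm {j} j≢i mᵢ∣mⱼ = record
      { form-cong = λ p → ≡-mod-∣ mᵢ∣mⱼ (at p j)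
      ; form-+    = coord-⊕ j
      ; form-≔    = λ x v → coord-≔-other x v j≢i }

    multiple-isForm : ∀ {j} q → j ≢ i → modulus i ≡ q ℕ.* modulus j → IsForm i (λ x → + q * coord j x)
    multiple-isForm {j} q j≢i mᵢ≡qmⱼ = record
      { form-cong = λ {x} {y} p → subst (+ q * coord j x ≡ + q * coord j y mod_) (sym mᵢ≡qmⱼ) (*-mod-* q (at p j))
      ; form-+    = λ x y → trans (cong (+ q *_) (coord-⊕ j x y)) (ℤ.*-distribˡ-+ (+ q) (coord j x) (coord j y))
      ; form-≔    = λ x v → cong (+ q *_) (coord-≔-other x v j≢i) }

    rowOp-isAutomorphism : ∀ s s′ {L} → IsForm i L → s′ * s ≡ 1ℤ mod modulus i → IsAutomorphism (rowOp i s L)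
    rowOp-isAutomorphism s s′ {L} L-form s′s≡1 = record
      { isHom        = record { ≋-cong = rowOp-cong s L-form ; ⊕-homo = rowOp-homo s L-form }
      ; inverse      = rowOp i s′ L⁻
      ; inverse-cong = rowOp-cong s′ L⁻-form
      ; inverseˡ     = λ x → ≋-trans (rowOp-∘ s′ L⁻ s L (form-≔ L⁻-form) x)
                               (≋-trans (rowOp-ext (s′ * s) _ (λ _ → 0ℤ) s′s≡1
                                                   (λ y → ≡⇒≡-mod (ℤ.+-inverseʳ (s′ * L y))) x)
                                        (rowOp-id x))
      ; inverseʳ     = λ x → ≋-trans (rowOp-∘ s L s′ L⁻ (form-≔ L-form) x)
                               (≋-trans (rowOp-ext (s * s′) _ (λ _ → 0ℤ) ss′≡1 (λ y → ss′-cancel (L y)) x) (rowOp-id x)) }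
      where
      L⁻ : 𝔾 → ℤ
      L⁻ y = - (s′ * L y)
      L⁻-form : IsForm i L⁻
      L⁻-form = record
        { form-cong = λ p → -‿cong-mod (*-congˡ-mod s′ (form-cong L-form p))
        ; form-+    = λ x y → trans (cong (λ l → - (s′ * l)) (form-+ L-form x y)) (distrib s′ (L x) (L y))
        ; form-≔    = λ x v → cong (λ l → - (s′ * l)) (form-≔ L-form x v) }
        where
        distrib : ∀ s a b → - (s * (a + b)) ≡ - (s * a) + - (s * b)
        distrib = solve-∀
      ss′≡1 : s * s′ ≡ 1ℤ mod modulus i
      ss′≡1 = subst (_≡ 1ℤ mod modulus i) (ℤ.*-comm s′ s) s′s≡1
      ss′-cancel : ∀ l → s * - (s′ * l) + l ≡ 0ℤ mod modulus i
      ss′-cancel l = begin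
        s * - (s′ * l) + l       ≡⟨ rearrange s s′ l ⟩
        l - s′ * s * l           ≈⟨ +-cong-mod (≡-mod-refl {a = l}) (-‿cong-mod (*-congʳ-mod l s′s≡1)) ⟩
        l - 1ℤ * l               ≡⟨ cong (λ a → l - a) (ℤ.*-identityˡ l) ⟩
        l - l                    ≡⟨ ℤ.+-inverseʳ l ⟩
        0ℤ                       ∎
        where
        open SetoidReasoning (≡-mod-setoid (modulus i))
        rearrange : ∀ s s′ l → s * - (s′ * l) + l ≡ l - s′ * s * l
        rearrange = solve-∀

  IsGenerated : (𝔾 → 𝔾) → Set
  IsGenerated = Generated k r μ

  generated-ext : ∀ {f g} → IsGenerated f → (∀ x → f x ≋ g x) → IsGenerated g
  generated-ext f-gen f≋g = ext f-gen (λ x → ≋⇒≈ (f≋g x))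

  generated-inverse : ∀ {f g} → IsGenerated f → (∀ {x y} → x ≋ y → g x ≋ g y) →
                      (∀ x → g (f x) ≋ x) → (∀ x → f (g x) ≋ x) → IsGenerated g
  generated-inverse f-gen g-cong gf≋id fg≋id =
    inv f-gen (λ x y p → ≋⇒≈ (g-cong (≈⇒≋ p))) (λ x → ≋⇒≈ (gf≋id x)) (λ x → ≋⇒≈ (fg≋id x))

  record GeneratedTransvection (i : Coord) (L : 𝔾 → ℤ) : Set where
    field
      isForm    : IsForm i L
      generated : IsGenerated (rowOp i 1ℤ L)

  module _ {i : Coord} where

    scaled-transvection : ∀ {L} → GeneratedTransvection i L → ∀ c → GeneratedTransvection i (λ x → c * L x)
    scaled-transvection {L} L-gen c = record { isForm = scaled-isForm i c isForm ; generated = powers c }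
      where
      open GeneratedTransvection L-gen
      _·L : ℤ → 𝔾 → ℤ
      (a ·L) x = a * L x
      compose : ∀ a b x → rowOp i 1ℤ (a ·L) (rowOp i 1ℤ (b ·L) x) ≋ rowOp i 1ℤ ((a + b) ·L) x
      compose a b x = ≋-trans (rowOp-∘ i 1ℤ (a ·L) 1ℤ (b ·L) (λ y v → cong (a *_) (form-≔ isForm y v)) x)
                              (rowOp-ext i 1ℤ _ ((a + b) ·L) ≡-mod-refl (λ y → ≡⇒≡-mod (collect a b (L y))) x)
        where
        collect : ∀ a b l → 1ℤ * (b * l) + a * l ≡ (a + b) * l
        collect = solve-∀
      trivial : ∀ a → a ≡ 0ℤ → ∀ x → rowOp i 1ℤ (a ·L) x ≋ x
      trivial a a≡0 x = ≋-trans (rowOp-ext i 1ℤ (a ·L) (λ _ → 0ℤ) ≡-mod-refl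
                                  (λ y → ≡⇒≡-mod (trans (cong (_* L y) a≡0) (ℤ.*-zeroˡ (L y)))) x)
                                (rowOp-id i x)
      cancelling : ∀ a b → a + b ≡ 0ℤ → ∀ x → rowOp i 1ℤ (a ·L) (rowOp i 1ℤ (b ·L) x) ≋ x
      cancelling a b a+b≡0 x = ≋-trans (compose a b x) (trivial (a + b) a+b≡0 x)
      powers-ℕ : ∀ n → IsGenerated (rowOp i 1ℤ ((+ n) ·L))
      powers-ℕ zero    = generated-ext idG (≋-sym ∘ trivial 0ℤ refl)
      powers-ℕ (suc n) = generated-ext (comp generated (powers-ℕ n)) λ x →
        ≋-trans (rowOp-ext i 1ℤ L (1ℤ ·L) ≡-mod-refl (λ y → ≡⇒≡-mod (sym (ℤ.*-identityˡ (L y))))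
                           (rowOp i 1ℤ ((+ n) ·L) x))
                (compose 1ℤ (+ n) x)
      powers : ∀ c → IsGenerated (rowOp i 1ℤ (c ·L))
      powers (+ n)    = powers-ℕ n
      powers -[1+ n ] = generated-inverse (powers-ℕ (suc n)) (rowOp-cong i 1ℤ (scaled-isForm i -[1+ n ] isForm))
                          (cancelling -[1+ n ] (+ suc n) (ℤ.+-inverseˡ (+ suc n)))
                          (cancelling (+ suc n) -[1+ n ] (ℤ.+-inverseʳ (+ suc n)))

    transvection-powers : ∀ {L} → GeneratedTransvection i L → ∀ c → IsGenerated (rowOp i 1ℤ (λ x → c * L x))
    transvection-powers L-gen c = GeneratedTransvection.generated (scaled-transvection L-gen c)

    zero-transvection : GeneratedTransvection i (λ _ → 0ℤ)
    zero-transvection = record { isForm = zero-isForm i ; generated = generated-ext idG (≋-sym ∘ rowOp-id i) }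

    +-transvection : ∀ {L L′} → GeneratedTransvection i L → GeneratedTransvection i L′ →
                     GeneratedTransvection i (λ x → L x + L′ x)
    +-transvection {L} {L′} L-gen L′-gen = record
      { isForm    = +-isForm i (isForm L-gen) (isForm L′-gen)
      ; generated = generated-ext (comp (generated L-gen) (generated L′-gen)) λ x →
          ≋-trans (rowOp-∘ i 1ℤ L 1ℤ L′ (form-≔ (isForm L-gen)) x)
                  (rowOp-ext i 1ℤ _ (λ y → L y + L′ y) ≡-mod-refl (λ y → ≡⇒≡-mod (swap (L′ y) (L y))) x) }
      where
      open GeneratedTransvection
      swap : ∀ a b → 1ℤ * a + b ≡ b + a
      swap = solve-∀

    ∑-transvection : ∀ {ℓ : Coord → 𝔾 → ℤ} → (∀ j → GeneratedTransvection i (ℓ j)) →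
                     GeneratedTransvection i (λ x → ∑ℤ (λ j → ℓ j x))
    ∑-transvection ℓ-gen = +-transvection (sum-transvection (ℓ-gen ∘ inj₁)) (sum-transvection (ℓ-gen ∘ inj₂))
      where
      sum-transvection : ∀ {n} {ℓ : Fin n → 𝔾 → ℤ} → (∀ a → GeneratedTransvection i (ℓ a)) →
                         GeneratedTransvection i (λ x → ℤΣ.sum (λ a → ℓ a x))
      sum-transvection {zero}  ℓ-gen = zero-transvection
      sum-transvection {suc n} ℓ-gen = +-transvection (ℓ-gen Fin.zero) (sum-transvection (ℓ-gen ∘ Fin.suc))

    transvection-≗ : ∀ {L L′} → (∀ x → L x ≡ L′ x) → GeneratedTransvection i L → GeneratedTransvection i L′
    transvection-≗ {L} {L′} L≗L′ L-gen = record
      { isForm    = record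
        { form-cong = λ {x} {y} p → subst₂ (_≡_mod modulus i) (L≗L′ x) (L≗L′ y) (form-cong (isForm L-gen) p)
        ; form-+    = λ x y → trans (sym (L≗L′ (x ⊕ y)))
                                  (trans (form-+ (isForm L-gen) x y) (cong₂ _+_ (L≗L′ x) (L≗L′ y)))
        ; form-≔    = λ x v → trans (sym (L≗L′ (x [ i ]≔ v))) (trans (form-≔ (isForm L-gen) x v) (L≗L′ x)) }
      ; generated = generated-ext (generated L-gen) (rowOp-ext i 1ℤ L L′ ≡-mod-refl (≡⇒≡-mod ∘ L≗L′)) }
      where open GeneratedTransvection

  colOp : Coord → 𝔾 → 𝔾 → 𝔾
  colOp c z x = x ⊕ coord c x • z

  module _ (c : Coord) where

    coord-colOp : ∀ z x j → coord j (colOp c z x) ≡ coord j x + coord c x * coord j z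
    coord-colOp z x j = trans (coord-⊕ j x (coord c x • z)) (cong (_+_ (coord j x)) (coord-• j (coord c x) z))

    colOp-fix : ∀ z {x} → coord c x ≡ 0ℤ → colOp c z x ≋ x
    colOp-fix z {x} xc≡0 = pointwise λ j → begin
      coord j (colOp c z x)               ≡⟨ coord-colOp z x j ⟩
      coord j x + coord c x * coord j z   ≡⟨ cong (λ a → coord j x + a * coord j z) xc≡0 ⟩
      coord j x + 0ℤ * coord j z          ≡⟨ ℤ.+-identityʳ (coord j x) ⟩
      coord j x                           ∎
      where open ≡-Reasoning

    colOp-⊕ : ∀ z₁ z₂ → coord c z₂ ≡ 0ℤ → ∀ x → colOp c z₁ (colOp c z₂ x) ≋ colOp c (z₁ ⊕ z₂) x
    colOp-⊕ z₁ z₂ z₂c≡0 x = pointwise λ j → begin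
      coord j (colOp c z₁ (colOp c z₂ x))
        ≡⟨ coord-colOp z₁ (colOp c z₂ x) j ⟩
      coord j (colOp c z₂ x) + coord c (colOp c z₂ x) * coord j z₁
        ≡⟨ cong₂ (λ a b → a + b * coord j z₁) (coord-colOp z₂ x j) (coord-colOp z₂ x c) ⟩
      coord j x + coord c x * coord j z₂ + (coord c x + coord c x * coord c z₂) * coord j z₁
        ≡⟨ cong (λ a → coord j x + coord c x * coord j z₂ + (coord c x + coord c x * a) * coord j z₁) z₂c≡0 ⟩
      coord j x + coord c x * coord j z₂ + (coord c x + coord c x * 0ℤ) * coord j z₁
        ≡⟨ rearrange (coord j x) (coord c x) (coord j z₁) (coord j z₂) ⟩
      coord j x + coord c x * (coord j z₁ + coord j z₂)
        ≡⟨ cong (λ a → coord j x + coord c x * a) (coord-⊕ j z₁ z₂) ⟨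
      coord j x + coord c x * coord j (z₁ ⊕ z₂)
        ≡⟨ coord-colOp (z₁ ⊕ z₂) x j ⟨
      coord j (colOp c (z₁ ⊕ z₂) x) ∎
      where
      open ≡-Reasoning
      rearrange : ∀ a b u v → a + b * v + (b + b * 0ℤ) * u ≡ a + b * (u + v)
      rearrange = solve-∀

    colOp-cong : ∀ {z z′} → z ≋ z′ → ∀ x → colOp c z x ≋ colOp c z′ x
    colOp-cong z≋z′ x = ⊕-cong (≋-refl {x}) (•-cong (coord c x) z≋z′)

    colOp-basis : ∀ {j} a → j ≢ c → ∀ x → colOp c (a • basis j) x ≋ rowOp j 1ℤ (λ y → a * coord c y) x
    colOp-basis {j} a j≢c x = ≋-split j (≡⇒≡-mod at-j) (λ j′ j′≢j → ≡⇒≡-mod (elsewhere j′ j′≢j))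
      where
      open ≡-Reasoning
      at-j : coord j (colOp c (a • basis j) x) ≡ coord j (rowOp j 1ℤ (λ y → a * coord c y) x)
      at-j = begin
        coord j (colOp c (a • basis j) x)          ≡⟨ coord-colOp (a • basis j) x j ⟩
        coord j x + coord c x * coord j (a • basis j)
          ≡⟨ cong (λ b → coord j x + coord c x * b) (trans (coord-• j a (basis j)) (cong (a *_) (coord-basis-same j))) ⟩
        coord j x + coord c x * (a * 1ℤ)           ≡⟨ rearrange (coord j x) (coord c x) a ⟩
        1ℤ * coord j x + a * coord c x             ≡⟨ coord-≔-same j x _ ⟨
        coord j (rowOp j 1ℤ (λ y → a * coord c y) x) ∎
        where
        rearrange : ∀ u b a → u + b * (a * 1ℤ) ≡ 1ℤ * u + a * b
        rearrange = solve-∀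
      elsewhere : ∀ j′ → j′ ≢ j →
                  coord j′ (colOp c (a • basis j) x) ≡ coord j′ (rowOp j 1ℤ (λ y → a * coord c y) x)
      elsewhere j′ j′≢j = begin
        coord j′ (colOp c (a • basis j) x)           ≡⟨ coord-colOp (a • basis j) x j′ ⟩
        coord j′ x + coord c x * coord j′ (a • basis j)
          ≡⟨ cong (λ b → coord j′ x + coord c x * b) (trans (coord-• j′ a (basis j)) (cong (a *_) (coord-basis-other j′≢j))) ⟩
        coord j′ x + coord c x * (a * 0ℤ)            ≡⟨ vanish (coord j′ x) (coord c x) a ⟩
        coord j′ x                                   ≡⟨ coord-≔-other x _ j′≢j ⟨
        coord j′ (rowOp j 1ℤ (λ y → a * coord c y) x) ∎
        where
        vanish : ∀ u b a → u + b * (a * 0ℤ) ≡ u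
        vanish = solve-∀

    colOp-0 : ∀ x → colOp c 0𝔾 x ≋ x
    colOp-0 x = pointwise λ j → begin
      coord j (colOp c 0𝔾 x)              ≡⟨ coord-colOp 0𝔾 x j ⟩
      coord j x + coord c x * coord j 0𝔾  ≡⟨ cong (λ a → coord j x + coord c x * a) (coord-0 j) ⟩
      coord j x + coord c x * 0ℤ          ≡⟨ cong (_+_ (coord j x)) (ℤ.*-zeroʳ (coord c x)) ⟩
      coord j x + 0ℤ                      ≡⟨ ℤ.+-identityʳ (coord j x) ⟩
      coord j x                           ∎
      where open ≡-Reasoning

    colOp-generated : ∀ z → coord c z ≡ 0ℤ →
                      (∀ j → j ≢ c → IsGenerated (rowOp j 1ℤ (λ y → coord j z * coord c y))) → IsGenerated (colOp c z)
    colOp-generated z zc≡0 pieces = generated-ext (comp (sum-generated inj₁) (sum-generated inj₂)) λ x →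
      ≋-trans (colOp-⊕ (𝔾Σ.sum (term ∘ inj₁)) (𝔾Σ.sum (term ∘ inj₂)) (sum-coord-c inj₂) x)
              (colOp-cong (≋-sym (expansion z)) x)
      where
      term : Coord → 𝔾
      term j = coord j z • basis j
      term-c : ∀ j → coord c (term j) ≡ 0ℤ
      term-c j with j ≟ c
      ... | yes refl = trans (coord-• c (coord c z) (basis c))
                             (trans (cong (_* coord c (basis c)) zc≡0) (ℤ.*-zeroˡ (coord c (basis c))))
      ... | no  j≢c  = trans (coord-• c (coord j z) (basis j))
                             (trans (cong (coord j z *_) (coord-basis-other (j≢c ∘ sym))) (ℤ.*-zeroʳ (coord j z)))
      term-generated : ∀ j → IsGenerated (colOp c (term j))
      term-generated j with j ≟ c
      ... | yes refl = generated-ext idG λ x → ≋-sym (≋-trans (colOp-cong term≋0 x) (colOp-0 x))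
        where
        term≋0 : term c ≋ 0𝔾
        term≋0 = pointwise λ j′ → trans (coord-• j′ (coord c z) (basis c))
                   (trans (cong (_* coord j′ (basis c)) zc≡0) (trans (ℤ.*-zeroˡ (coord j′ (basis c))) (sym (coord-0 j′))))
      ... | no  j≢c  = generated-ext (pieces j j≢c) (λ x → ≋-sym (colOp-basis (coord j z) j≢c x))
      sum-coord-c : ∀ {n} (h : Fin n → Coord) → coord c (𝔾Σ.sum (term ∘ h)) ≡ 0ℤ
      sum-coord-c {n} h = trans (coord-sum c (term ∘ h)) (trans (ℤΣ.sum-cong-≗ (term-c ∘ h)) (ℤΣ.sum-replicate-zero n))
      sum-generated : ∀ {n} (h : Fin n → Coord) → IsGenerated (colOp c (𝔾Σ.sum (term ∘ h)))
      sum-generated {zero}  h = generated-ext idG (≋-sym ∘ colOp-0)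
      sum-generated {suc n} h = generated-ext (comp (term-generated (h Fin.zero)) (sum-generated (h ∘ Fin.suc)))
                                  (colOp-⊕ (term (h Fin.zero)) (𝔾Σ.sum (term ∘ h ∘ Fin.suc)) (sum-coord-c (h ∘ Fin.suc)))

  clearing : Coord → 𝔾 → 𝔾
  clearing c v = (⊖ v) [ c ]≔ 0ℤ

  colOp-clears : ∀ c v → coord c v ≡ 1ℤ mod modulus c → (∀ j → + modulus c * coord j v ≡ 0ℤ mod modulus j) →
                 colOp c (clearing c v) v ≋ basis c
  colOp-clears c v vc≡1 Mv≡0 = ≋-split c at-c elsewhere
    where
    at-c : coord c (colOp c (clearing c v) v) ≡ coord c (basis c) mod modulus c
    at-c = begin
      coord c (colOp c (clearing c v) v)           ≡⟨ coord-colOp c (clearing c v) v c ⟩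
      coord c v + coord c v * coord c (clearing c v) ≡⟨ cong (λ a → coord c v + coord c v * a) (coord-≔-same c (⊖ v) 0ℤ) ⟩
      coord c v + coord c v * 0ℤ                   ≡⟨ cong (_+_ (coord c v)) (ℤ.*-zeroʳ (coord c v)) ⟩
      coord c v + 0ℤ                               ≡⟨ ℤ.+-identityʳ (coord c v) ⟩
      coord c v                                    ≈⟨ vc≡1 ⟩
      1ℤ                                           ≡⟨ coord-basis-same c ⟨
      coord c (basis c)                            ∎
      where open SetoidReasoning (≡-mod-setoid (modulus c))
    elsewhere : ∀ j → j ≢ c → coord j (colOp c (clearing c v) v) ≡ coord j (basis c) mod modulus j
    elsewhere j j≢c with divides-difference vc≡1
    ... | divides t vc-1≡tM = begin
      coord j (colOp c (clearing c v) v)             ≡⟨ coord-colOp c (clearing c v) v j ⟩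
      coord j v + coord c v * coord j (clearing c v)
        ≡⟨ cong (λ a → coord j v + coord c v * a) (trans (coord-≔-other (⊖ v) 0ℤ j≢c) (coord-⊖ j v)) ⟩
      coord j v + coord c v * - coord j v            ≡⟨ rearrange (coord c v) (coord j v) ⟩
      - ((coord c v - 1ℤ) * coord j v)               ≡⟨ cong (λ a → - (a * coord j v)) vc-1≡tM ⟩
      - (t * + modulus c * coord j v)                ≡⟨ cong -_ (ℤ.*-assoc t (+ modulus c) (coord j v)) ⟩
      - (t * (+ modulus c * coord j v))              ≈⟨ -‿cong-mod (*-congˡ-mod t (Mv≡0 j)) ⟩
      - (t * 0ℤ)                                     ≡⟨ cong -_ (ℤ.*-zeroʳ t) ⟩
      0ℤ                                             ≡⟨ coord-basis-other j≢c ⟨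
      coord j (basis c)                              ∎
      where
      open SetoidReasoning (≡-mod-setoid (modulus j))
      rearrange : ∀ a b → b + a * - b ≡ - ((a - 1ℤ) * b)
      rearrange = solve-∀

  position : Coord → ℕ
  position (inj₁ l) = toℕ l
  position (inj₂ i) = k ℕ.+ toℕ i

  position-injective : ∀ {i j} → position i ≡ position j → i ≡ j
  position-injective {inj₁ l} {inj₁ l′} eq = cong inj₁ (Fin.toℕ-injective eq)
  position-injective {inj₁ l} {inj₂ i}  eq = ⊥-elim (ℕ.<⇒≱ (Fin.toℕ<n l) (subst (k ℕ.≤_) (sym eq) (ℕ.m≤m+n k _)))
  position-injective {inj₂ i} {inj₁ l}  eq = ⊥-elim (ℕ.<⇒≱ (Fin.toℕ<n l) (subst (k ℕ.≤_) eq (ℕ.m≤m+n k _)))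
  position-injective {inj₂ i} {inj₂ i′} eq = cong inj₂ (Fin.toℕ-injective (ℕ.+-cancelˡ-≡ k _ _ eq))

  position-splitAt : ∀ p → position (Fin.splitAt k p) ≡ toℕ p
  position-splitAt p = trans (position-join (Fin.splitAt k p)) (cong toℕ (Fin.join-splitAt k r p))
    where
    position-join : ∀ c → position c ≡ toℕ (Fin.join k r c)
    position-join (inj₁ l) = sym (Fin.toℕ-↑ˡ l r)
    position-join (inj₂ i) = sym (Fin.toℕ-↑ʳ k i)

  FixesBelow : (𝔾 → 𝔾) → ℕ → Set
  FixesBelow F n = ∀ j → position j ℕ.< n → F (basis j) ≋ basis j

  fixesBelow-∘ : ∀ {H F n} → (∀ {x y} → x ≋ y → H x ≋ H y) → FixesBelow F n →
                 (∀ j → position j ℕ.< n → H (basis j) ≋ basis j) → FixesBelow (H ∘ F) n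
  fixesBelow-∘ H-cong F-fixes H-fixes j j<n = ≋-trans (H-cong (F-fixes j j<n)) (H-fixes j j<n)

  fixesBelow-extend : ∀ {F c} → FixesBelow F (position c) → F (basis c) ≋ basis c → FixesBelow F (suc (position c))
  fixesBelow-extend {F} {c} F-fixes F-fixes-c j j≤c with ℕ.m≤n⇒m<n∨m≡n (ℕ.s≤s⁻¹ j≤c)
  ... | inj₁ j<c = F-fixes j j<c
  ... | inj₂ j≡c = subst (λ j → F (basis j) ≋ basis j) (sym (position-injective j≡c)) F-fixes-c

  below⇒≢ : ∀ {j c} → position j ℕ.< position c → j ≢ c
  below⇒≢ j<c refl = ℕ.<-irrefl refl j<c

  module _ {F} (F-aut : IsAutomorphism F) where
    open IsAutomorphism F-aut

    pivot-identity : ∀ c → 1ℤ ≡ ∑ℤ (λ j → coord j (F (basis c)) * coord c (inverse (basis j))) mod modulus c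
    pivot-identity c = begin
      1ℤ                                  ≡⟨ coord-basis-same c ⟨
      coord c (basis c)                   ≈⟨ at (inverseˡ (basis c)) c ⟨
      coord c (inverse (F (basis c)))     ≈⟨ coord-hom (IsAutomorphism.isHom (inverse-isAutomorphism F-aut)) c (F (basis c)) ⟩
      ∑ℤ (λ j → coord j (F (basis c)) * coord c (inverse (basis j))) ∎
      where open SetoidReasoning (≡-mod-setoid (modulus c))

    inverse-fixesBelow : ∀ {n} → FixesBelow F n → FixesBelow inverse n
    inverse-fixesBelow F-fixes j j<n = ≋-trans (inverse-cong (≋-sym (F-fixes j j<n))) (inverseˡ (basis j))

module Generation (k r : ℕ) (μ : Fin r → ℕ) (μ-nonZero : ∀ i → NonZero (μ i))
                  (μ-chain : ∀ (i j : Fin r) → i Fin.≤ j → μ j ℕ.∣ μ i) where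

  open Group k r μ

  ψ-act : ∀ i x → act k r μ (ψ i) x ≋ rowOp (inj₁ i) -1ℤ (λ _ → 0ℤ) x
  ψ-act i x = ≔-≡ (inj₁ i) x (sym (trans (ℤ.+-identityʳ (-1ℤ * proj₁ x i)) (ℤ.-1*i≡-i (proj₁ x i))))

  ψu-act : ∀ i u p x → act k r μ (ψu i u p) x ≋ rowOp (inj₂ i) u (λ _ → 0ℤ) x
  ψu-act i u p x = ≔-≡ (inj₂ i) x (sym (ℤ.+-identityʳ (u * proj₂ x i)))

  α-act : ∀ i j i≢j x → act k r μ (α i j i≢j) x ≋ rowOp (inj₁ i) 1ℤ (coord (inj₁ j)) x
  α-act i j _ x = ≔-≡ (inj₁ i) x (cong (_+ proj₁ x j) (sym (ℤ.*-identityˡ (proj₁ x i))))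

  β-act : ∀ i j x → act k r μ (β i j) x ≋ rowOp (inj₂ i) 1ℤ (coord (inj₁ j)) x
  β-act i j x = ≔-≡ (inj₂ i) x (cong (_+ proj₁ x j) (sym (ℤ.*-identityˡ (proj₂ x i))))

  γ-act : ∀ i j j<i x → act k r μ (γ i j j<i) x ≋ rowOp (inj₂ i) 1ℤ (coord (inj₂ j)) x
  γ-act i j _ x = ≔-≡ (inj₂ i) x (cong (_+ proj₂ x j) (sym (ℤ.*-identityˡ (proj₂ x i))))

  δ-act : ∀ i j i<j μⱼ∣μᵢ x → act k r μ (δ i j i<j μⱼ∣μᵢ) x ≋
                               rowOp (inj₂ i) 1ℤ (λ y → + ℕ.quotient μⱼ∣μᵢ * coord (inj₂ j) y) x
  δ-act i j _ μⱼ∣μᵢ x =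
    ≔-≡ (inj₂ i) x (cong (_+ (+ ℕ.quotient μⱼ∣μᵢ * proj₂ x j)) (sym (ℤ.*-identityˡ (proj₂ x i))))

  α-isForm : ∀ {i j} → i ≢ j → IsForm (inj₁ i) (coord (inj₁ j))
  α-isForm i≢j = coord-isForm _ (i≢j ∘ sym ∘ Sum.inj₁-injective) ℕ.∣-refl

  β-isForm : ∀ i j → IsForm (inj₂ i) (coord (inj₁ j))
  β-isForm i j = coord-isForm (inj₂ i) {inj₁ j} (λ ()) (μ i ℕ.∣0)

  γ-isForm : ∀ {i j} → j Fin.< i → IsForm (inj₂ i) (coord (inj₂ j))
  γ-isForm {i} {j} j<i = coord-isForm _ (Fin.<⇒≢ j<i ∘ Sum.inj₂-injective) (μ-chain j i (ℕ.<⇒≤ j<i))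

  δ-isForm : ∀ {i j} → i Fin.< j → (μⱼ∣μᵢ : μ j ℕ.∣ μ i) →
             IsForm (inj₂ i) (λ y → + ℕ.quotient μⱼ∣μᵢ * coord (inj₂ j) y)
  δ-isForm i<j μⱼ∣μᵢ = multiple-isForm _ (ℕ.quotient μⱼ∣μᵢ) (Fin.<⇒≢ i<j ∘ sym ∘ Sum.inj₂-injective)
                                       (ℕ._∣_.equality μⱼ∣μᵢ)

  act-isAutomorphism : ∀ g → IsAutomorphism (act k r μ g)
  act-isAutomorphism (ψ i) =
    ext-isAutomorphism (rowOp-isAutomorphism (inj₁ i) -1ℤ -1ℤ (zero-isForm (inj₁ i)) ≡-mod-refl) (≋-sym ∘ ψ-act i)
  act-isAutomorphism (ψu i u (v , μᵢ∣uv-1)) =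
    ext-isAutomorphism (rowOp-isAutomorphism (inj₂ i) u v (zero-isForm (inj₂ i))
                                             (subst (_≡ 1ℤ mod μ i) (ℤ.*-comm u v) (∣ᵘ⇒≡-mod μᵢ∣uv-1)))
                       (≋-sym ∘ ψu-act i u (v , μᵢ∣uv-1))
  act-isAutomorphism (α i j i≢j) =
    ext-isAutomorphism (rowOp-isAutomorphism (inj₁ i) 1ℤ 1ℤ (α-isForm i≢j) ≡-mod-refl) (≋-sym ∘ α-act i j i≢j)
  act-isAutomorphism (β i j) =
    ext-isAutomorphism (rowOp-isAutomorphism (inj₂ i) 1ℤ 1ℤ (β-isForm i j) ≡-mod-refl) (≋-sym ∘ β-act i j)
  act-isAutomorphism (γ i j j<i) =
    ext-isAutomorphism (rowOp-isAutomorphism (inj₂ i) 1ℤ 1ℤ (γ-isForm j<i) ≡-mod-refl) (≋-sym ∘ γ-act i j j<i)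
  act-isAutomorphism (δ i j i<j μⱼ∣μᵢ) =
    ext-isAutomorphism (rowOp-isAutomorphism (inj₂ i) 1ℤ 1ℤ (δ-isForm i<j μⱼ∣μᵢ) ≡-mod-refl)
                       (≋-sym ∘ δ-act i j i<j μⱼ∣μᵢ)

  generated⇒isAutomorphism : ∀ {f} → IsGenerated f → IsAutomorphism f
  generated⇒isAutomorphism (gen g)                 = act-isAutomorphism g
  generated⇒isAutomorphism idG                     = id-isAutomorphism
  generated⇒isAutomorphism (comp f-gen g-gen)      =
    ∘-isAutomorphism (generated⇒isAutomorphism f-gen) (generated⇒isAutomorphism g-gen)
  generated⇒isAutomorphism (inv f-gen g-cong gf fg) =
    isAutomorphism-inverse (generated⇒isAutomorphism f-gen) (λ p → ≈⇒≋ (g-cong _ _ (≋⇒≈ p))) (≈⇒≋ ∘ gf) (≈⇒≋ ∘ fg)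
  generated⇒isAutomorphism (ext f-gen f≈g)         = ext-isAutomorphism (generated⇒isAutomorphism f-gen) (≈⇒≋ ∘ f≈g)

  generated-cancel : ∀ {H F} → IsGenerated H → IsGenerated (H ∘ F) → IsGenerated F
  generated-cancel {H} {F} H-gen HF-gen =
    generated-ext (comp (generated-inverse H-gen inverse-cong inverseˡ inverseʳ) HF-gen) (λ x → inverseˡ (F x))
    where open IsAutomorphism (generated⇒isAutomorphism H-gen)

  α-transvection : ∀ {i j} (i≢j : i ≢ j) → GeneratedTransvection (inj₁ i) (coord (inj₁ j))
  α-transvection {i} {j} i≢j = record { isForm = α-isForm i≢j ; generated = generated-ext (gen (α i j i≢j)) (α-act i j i≢j) }

  β-transvection : ∀ i j → GeneratedTransvection (inj₂ i) (coord (inj₁ j))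
  β-transvection i j = record { isForm = β-isForm i j ; generated = generated-ext (gen (β i j)) (β-act i j) }

  γ-transvection : ∀ {i j} (j<i : j Fin.< i) → GeneratedTransvection (inj₂ i) (coord (inj₂ j))
  γ-transvection {i} {j} j<i = record { isForm = γ-isForm j<i ; generated = generated-ext (gen (γ i j j<i)) (γ-act i j j<i) }

  δ-transvection : ∀ {i j} (i<j : i Fin.< j) (μⱼ∣μᵢ : μ j ℕ.∣ μ i) →
                   GeneratedTransvection (inj₂ i) (λ x → + ℕ.quotient μⱼ∣μᵢ * coord (inj₂ j) x)
  δ-transvection {i} {j} i<j μⱼ∣μᵢ =
    record { isForm    = δ-isForm i<j μⱼ∣μᵢ
           ; generated = generated-ext (gen (δ i j i<j μⱼ∣μᵢ)) (δ-act i j i<j μⱼ∣μᵢ) }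

  FixingBelow⇒Generated : ℕ → Set
  FixingBelow⇒Generated n = ∀ {F} → IsAutomorphism F → FixesBelow F n → IsGenerated F

  reduce-by : ∀ {H F n} → IsGenerated H → (∀ j → position j ℕ.< n → H (basis j) ≋ basis j) →
              IsAutomorphism F → FixesBelow F n →
              (IsAutomorphism (H ∘ F) → FixesBelow (H ∘ F) n → IsGenerated (H ∘ F)) → IsGenerated F
  reduce-by {H} {F} H-gen H-fixes F-aut F-fixes continue = generated-cancel H-gen
    (continue (∘-isAutomorphism H-aut F-aut) (fixesBelow-∘ {H} {F} (IsAutomorphism.≋-cong H-aut) F-fixes H-fixes))
    where H-aut = generated⇒isAutomorphism H-gen

  finish-column : ∀ c → FixingBelow⇒Generated (suc (position c)) →
                  ∀ {F} → IsAutomorphism F → FixesBelow F (position c) →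
                  coord c (F (basis c)) ≡ 1ℤ mod modulus c →
                  (∀ j → + modulus c * coord j (F (basis c)) ≡ 0ℤ mod modulus j) →
                  (∀ j → j ≢ c → IsGenerated (rowOp j 1ℤ (λ y → - coord j (F (basis c)) * coord c y))) →
                  IsGenerated F
  finish-column c next {F} F-aut F-fixes vc≡1 Mv≡0 pieces =
    reduce-by {colOp c z} clearing-generated (λ j j<c → colOp-fix c z (coord-basis-other {j} {c} (below⇒≢ j<c ∘ sym)))
              F-aut F-fixes
      (λ CF-aut CF-fixes → next CF-aut (fixesBelow-extend {colOp c z ∘ F} {c} CF-fixes (colOp-clears c v vc≡1 Mv≡0)))
    where
    v = F (basis c)
    z = clearing c v
    zⱼ≡-vⱼ : ∀ {j} → j ≢ c → coord j z ≡ - coord j v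
    zⱼ≡-vⱼ {j} j≢c = trans (coord-≔-other (⊖ v) 0ℤ j≢c) (coord-⊖ j v)
    clearing-generated : IsGenerated (colOp c z)
    clearing-generated = colOp-generated c z (coord-≔-same c (⊖ v) 0ℤ) λ j j≢c →
      generated-ext (pieces j j≢c)
                    (rowOp-ext j 1ℤ _ _ ≡-mod-refl (λ y → ≡⇒≡-mod (cong (_* coord c y) (sym (zⱼ≡-vⱼ {j} j≢c)))))

  record SupportedOn (a b : Coord) (H : 𝔾 → 𝔾) : Set where
    field
      generated : IsGenerated H
      untouched : ∀ x {j} → j ≢ a → j ≢ b → coord j (H x) ≡ coord j x
      fixes     : ∀ {x} → coord a x ≡ 0ℤ → coord b x ≡ 0ℤ → H x ≋ x

  module _ {a b : Coord} where

    supported-id : SupportedOn a b id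
    supported-id = record { generated = idG ; untouched = λ _ _ _ → refl ; fixes = λ _ _ → ≋-refl }

    supported-∘ : ∀ {H H′} → SupportedOn a b H → SupportedOn a b H′ → SupportedOn a b (H ∘ H′)
    supported-∘ {H} {H′} H-sup H′-sup = record
      { generated = comp (generated H-sup) (generated H′-sup)
      ; untouched = λ x j≢a j≢b → trans (untouched H-sup (H′ x) j≢a j≢b) (untouched H′-sup x j≢a j≢b)
      ; fixes     = λ {x} xa≡0 xb≡0 →
          ≋-trans (IsAutomorphism.≋-cong (generated⇒isAutomorphism (generated H-sup)) (fixes H′-sup xa≡0 xb≡0))
                  (fixes H-sup xa≡0 xb≡0) }
      where open SupportedOn

    supported-transvection : b ≢ a → GeneratedTransvection a (coord b) →
                             ∀ c → SupportedOn a b (rowOp a 1ℤ (λ x → c * coord b x))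
    supported-transvection b≢a T c = record
      { generated = transvection-powers T c
      ; untouched = λ x j≢a _ → coord-≔-other x _ j≢a
      ; fixes     = λ xa≡0 xb≡0 →
          rowOp-fix a 1ℤ (λ x → c * coord b x) xa≡0 (≡⇒≡-mod (trans (cong (c *_) xb≡0) (ℤ.*-zeroʳ c))) }

  supported-sym : ∀ {a b H} → SupportedOn a b H → SupportedOn b a H
  supported-sym H-sup = record
    { generated = generated
    ; untouched = λ x j≢b j≢a → untouched x j≢a j≢b
    ; fixes     = λ xb≡0 xa≡0 → fixes xa≡0 xb≡0 }
    where open SupportedOn H-sup

  module _ {a b : Coord} (a≢b : a ≢ b) (b-to-a : GeneratedTransvection a (coord b)) (a-to-b : GeneratedTransvection b (coord a)) where

    private
      addB addA : ℤ → 𝔾 → 𝔾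
      addB c = rowOp a 1ℤ (λ x → c * coord b x)
      addA c = rowOp b 1ℤ (λ x → c * coord a x)

      b≢a : b ≢ a
      b≢a = a≢b ∘ sym

    quarterTurn : 𝔾 → 𝔾
    quarterTurn = addA 1ℤ ∘ addB -1ℤ ∘ addA 1ℤ

    quarterTurn-supported : SupportedOn a b quarterTurn
    quarterTurn-supported = supported-∘ addA₁ (supported-∘ (supported-transvection b≢a b-to-a -1ℤ) addA₁)
      where addA₁ = supported-sym (supported-transvection a≢b a-to-b 1ℤ)

    quarterTurn-b : ∀ x → coord b (quarterTurn x) ≡ coord a x
    quarterTurn-b x = begin
      coord b (quarterTurn x)                           ≡⟨ coord-≔-same b w₂ _ ⟩
      1ℤ * coord b w₂ + 1ℤ * coord a w₂
        ≡⟨ cong₂ (λ p q → 1ℤ * p + 1ℤ * q) (coord-≔-other w₁ _ b≢a) (coord-≔-same a w₁ _) ⟩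
      1ℤ * coord b w₁ + 1ℤ * (1ℤ * coord a w₁ + -1ℤ * coord b w₁)
        ≡⟨ cong₂ (λ p q → 1ℤ * q + 1ℤ * (1ℤ * p + -1ℤ * q)) (coord-≔-other x _ a≢b) (coord-≔-same b x _) ⟩
      1ℤ * (1ℤ * coord b x + 1ℤ * coord a x) + 1ℤ * (1ℤ * coord a x + -1ℤ * (1ℤ * coord b x + 1ℤ * coord a x))
        ≡⟨ turn (coord a x) (coord b x) ⟩
      coord a x                                         ∎
      where
      open ≡-Reasoning
      w₁ = addA 1ℤ x
      w₂ = addB -1ℤ w₁
      turn : ∀ p q → 1ℤ * (1ℤ * q + 1ℤ * p) + 1ℤ * (1ℤ * p + -1ℤ * (1ℤ * q + 1ℤ * p)) ≡ p
      turn = solve-∀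

    -- Each round replaces (x_a, x_b) by (-x_b, x_a mod x_b).
    euclid : ∀ v → Σ (𝔾 → 𝔾) λ H → SupportedOn a b H × coord b (H v) ≡ 0ℤ
    euclid v = <-rec P round ∣ coord b v ∣ v refl
      where
      P : ℕ → Set
      P n = ∀ v → ∣ coord b v ∣ ≡ n → Σ (𝔾 → 𝔾) λ H → SupportedOn a b H × coord b (H v) ≡ 0ℤ
      round : ∀ n → (∀ {m} → m ℕ.< n → P m) → P n
      round _ rec v refl with coord b v ℤ.≟ 0ℤ
      ... | yes vb≡0 = id , supported-id , vb≡0
      ... | no  vb≢0 = H ∘ (quarterTurn ∘ addB (- q)) ,
                       supported-∘ H-sup (supported-∘ quarterTurn-supported (supported-transvection b≢a b-to-a (- q))) ,
                       Hv′b≡0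
        where
        instance
          _ = ℤ.≢-nonZero vb≢0
        q = coord a v ℤ./ coord b v
        ρ = coord a v ℤ.% coord b v
        v′ = quarterTurn (addB (- q) v)
        v′b≡ρ : coord b v′ ≡ + ρ
        v′b≡ρ = begin
          coord b v′                               ≡⟨ quarterTurn-b (addB (- q) v) ⟩
          coord a (addB (- q) v)                   ≡⟨ coord-≔-same a v _ ⟩
          1ℤ * coord a v + - q * coord b v
            ≡⟨ cong (λ p → 1ℤ * p + - q * coord b v) (ℤ.a≡a%n+[a/n]*n (coord a v) (coord b v)) ⟩
          1ℤ * (+ ρ + q * coord b v) + - q * coord b v ≡⟨ reduce (+ ρ) q (coord b v) ⟩
          + ρ                                      ∎
          where
          open ≡-Reasoning
          reduce : ∀ r q y → 1ℤ * (r + q * y) + - q * y ≡ r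
          reduce = solve-∀
        smaller = rec (ℤ.n%d<d (coord a v) (coord b v)) v′ (cong ∣_∣ v′b≡ρ)
        H = proj₁ smaller
        H-sup = proj₁ (proj₂ smaller)
        Hv′b≡0 = proj₂ (proj₂ smaller)

  free-column-generated : ∀ m a j → j ≢ inj₁ m → IsGenerated (rowOp j 1ℤ (λ y → a * coord (inj₁ m) y))
  free-column-generated m a (inj₁ l) l≢m = transvection-powers (α-transvection (l≢m ∘ cong inj₁)) a
  free-column-generated m a (inj₂ i) _   = transvection-powers (β-transvection i m) a

  module FreeStep (m : Fin k) (next : FixingBelow⇒Generated (suc (toℕ m))) where

    c₀ : Coord
    c₀ = inj₁ m

    Cleared : (𝔾 → 𝔾) → ℕ → Set
    Cleared F n = ∀ l → m Fin.< l → toℕ l ℕ.< n → coord (inj₁ l) (F (basis c₀)) ≡ 0ℤ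

    pivot-unit : ∀ {F} → IsAutomorphism F → FixesBelow F (toℕ m) → Cleared F k →
                 coord c₀ (F (basis c₀)) ≡ 1ℤ ⊎ coord c₀ (F (basis c₀)) ≡ -1ℤ
    pivot-unit {F} F-aut F-fixes cleared = i*j≡1⇒i≡1∨i≡-1 (coord c₀ v) (y c₀)
      (sym (mod-0⇒≡ (≡-mod-trans (pivot-identity F-aut c₀)
                                 (∑ℤ-single _ c₀ (λ j j≢c₀ → ≡⇒≡-mod (off-pivot j j≢c₀))))))
      where
      open IsAutomorphism F-aut
      v = F (basis c₀)
      y : Coord → ℤ
      y j = coord c₀ (inverse (basis j))
      y-below : ∀ {l} → l Fin.< m → y (inj₁ l) ≡ 0ℤ
      y-below {l} l<m = trans (mod-0⇒≡ (at (inverse-fixesBelow F-aut F-fixes (inj₁ l) l<m) c₀))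
                              (coord-basis-other (Fin.<⇒≢ l<m ∘ sym ∘ Sum.inj₁-injective))
      y-torsion : ∀ i → y (inj₂ i) ≡ 0ℤ
      y-torsion i = torsion⇒free-coord≡0 (μ i) {{μ-nonZero i}}
                      (hom-torsion (IsAutomorphism.isHom (inverse-isAutomorphism F-aut)) i) m
      off-pivot : ∀ j → j ≢ c₀ → coord j v * y j ≡ 0ℤ
      off-pivot (inj₁ l) l≢m with Fin.<-cmp l m
      ... | tri< l<m _ _ = trans (cong (coord (inj₁ l) v *_) (y-below l<m)) (ℤ.*-zeroʳ (coord (inj₁ l) v))
      ... | tri≈ _ l≡m _ = ⊥-elim (l≢m (cong inj₁ l≡m))
      ... | tri> _ _ m<l = trans (cong (_* y (inj₁ l)) (cleared l m<l (Fin.toℕ<n l))) (ℤ.*-zeroˡ (y (inj₁ l)))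
      off-pivot (inj₂ i) _ = trans (cong (coord (inj₂ i) v *_) (y-torsion i)) (ℤ.*-zeroʳ (coord (inj₂ i) v))

    finish : ∀ {F} → IsAutomorphism F → FixesBelow F (toℕ m) → coord c₀ (F (basis c₀)) ≡ 1ℤ → IsGenerated F
    finish {F} F-aut F-fixes v₀≡1 = finish-column c₀ next F-aut F-fixes (≡⇒≡-mod v₀≡1)
      (λ j → ≡⇒≡-mod (ℤ.*-zeroˡ (coord j (F (basis c₀))))) (λ j → free-column-generated m (- coord j (F (basis c₀))) j)

    ClearedBelow⇒Generated : ℕ → Set
    ClearedBelow⇒Generated n = ∀ {F} → IsAutomorphism F → FixesBelow F (toℕ m) → Cleared F n → IsGenerated F

    fully-cleared : ClearedBelow⇒Generated k
    fully-cleared {F} F-aut F-fixes cleared = [ finish F-aut F-fixes , flip-then-finish ]′ (pivot-unit F-aut F-fixes cleared)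
      where
      flip : 𝔾 → 𝔾
      flip = rowOp c₀ -1ℤ (λ _ → 0ℤ)
      flip-generated : IsGenerated flip
      flip-generated = generated-ext (gen (ψ m)) (ψ-act m)
      flip-fixes : ∀ j → position j ℕ.< toℕ m → flip (basis j) ≋ basis j
      flip-fixes j j<m = rowOp-fix c₀ -1ℤ (λ _ → 0ℤ) (coord-basis-other {j} {c₀} (below⇒≢ j<m ∘ sym)) ≡-mod-refl
      flip-then-finish : coord c₀ (F (basis c₀)) ≡ -1ℤ → IsGenerated F
      flip-then-finish v₀≡-1 = reduce-by {flip} flip-generated flip-fixes F-aut F-fixes λ flipF-aut flipF-fixes →
        finish flipF-aut flipF-fixes (trans (coord-≔-same c₀ (F (basis c₀)) (-1ℤ * coord c₀ (F (basis c₀)) + 0ℤ))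
                                            (cong (λ a → -1ℤ * a + 0ℤ) v₀≡-1))

    clear-position : ∀ p → ClearedBelow⇒Generated (suc (toℕ p)) → ClearedBelow⇒Generated (toℕ p)
    clear-position p continue {F} F-aut F-fixes cleared = [ by-euclid , skip ]′ (toSum (m Fin.<? p))
      where
      skip : ¬ m Fin.< p → IsGenerated F
      skip m≮p = continue F-aut F-fixes λ l m<l l≤p →
        cleared l m<l (ℕ.≤∧≢⇒< (ℕ.s≤s⁻¹ l≤p) (λ l≡p → m≮p (subst (m Fin.<_) (Fin.toℕ-injective l≡p) m<l)))
      by-euclid : m Fin.< p → IsGenerated F
      by-euclid m<p = reduce-by {H} generated H-fixes F-aut F-fixes λ HF-aut HF-fixes →
                        continue HF-aut HF-fixes cleared′
        where
        m≢p : m ≢ p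
        m≢p = Fin.<⇒≢ m<p
        reduction = euclid (m≢p ∘ Sum.inj₁-injective) (α-transvection m≢p) (α-transvection (m≢p ∘ sym)) (F (basis c₀))
        H = proj₁ reduction
        H-supported = proj₁ (proj₂ reduction)
        open SupportedOn H-supported
        H-fixes : ∀ j → position j ℕ.< toℕ m → H (basis j) ≋ basis j
        H-fixes j j<m = fixes (coord-basis-other {j} {c₀} (below⇒≢ j<m ∘ sym))
                              (coord-basis-other {j} {inj₁ p} (below⇒≢ {j} {inj₁ p} (ℕ.<-trans j<m m<p) ∘ sym))
        cleared′ : Cleared (H ∘ F) (suc (toℕ p))
        cleared′ l m<l l≤p = [ earlier , at-p ]′ (ℕ.m≤n⇒m<n∨m≡n (ℕ.s≤s⁻¹ l≤p))
          where
          earlier : toℕ l ℕ.< toℕ p → coord (inj₁ l) (H (F (basis c₀))) ≡ 0ℤ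
          earlier l<p = trans (untouched (F (basis c₀)) (Fin.<⇒≢ m<l ∘ sym ∘ Sum.inj₁-injective)
                                                        (Fin.<⇒≢ l<p ∘ Sum.inj₁-injective))
                              (cleared l m<l l<p)
          at-p : toℕ l ≡ toℕ p → coord (inj₁ l) (H (F (basis c₀))) ≡ 0ℤ
          at-p l≡p = subst (λ l → coord (inj₁ l) (H (F (basis c₀))) ≡ 0ℤ) (sym (Fin.toℕ-injective l≡p))
                           (proj₂ (proj₂ reduction))

    free-step : FixingBelow⇒Generated (toℕ m)
    free-step F-aut F-fixes = downward-induction ClearedBelow⇒Generated k fully-cleared clear-position F-aut F-fixes (λ _ _ ())

  δ-multiple-transvection : ∀ {i j} (i<j : i Fin.< j) (μⱼ∣μᵢ : μ j ℕ.∣ μ i) {a} →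
                            + ℕ.quotient μⱼ∣μᵢ ∣ℤ a →
                            GeneratedTransvection (inj₂ i) (λ x → a * coord (inj₂ j) x)
  δ-multiple-transvection {i} {j} i<j μⱼ∣μᵢ (divides s a≡sq) = transvection-≗
    (λ x → trans (sym (ℤ.*-assoc s (+ ℕ.quotient μⱼ∣μᵢ) (coord (inj₂ j) x))) (cong (_* coord (inj₂ j) x) (sym a≡sq)))
    (scaled-transvection (δ-transvection i<j μⱼ∣μᵢ) s)

  quotient∣ : ∀ {i j} (μⱼ∣μᵢ : μ j ℕ.∣ μ i) {z} → + μ j * z ≡ 0ℤ mod μ i → + ℕ.quotient μⱼ∣μᵢ ∣ℤ z
  quotient∣ {i} {j} μⱼ∣μᵢ {z} μⱼz≡0 =
    n*z≡0-mod-q*n⇒q∣z (ℕ.quotient μⱼ∣μᵢ) (μ j) {{μ-nonZero j}}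
                      (subst (+ μ j * z ≡ 0ℤ mod_) (ℕ._∣_.equality μⱼ∣μᵢ) μⱼz≡0)

  torsion-row-transvection : ∀ m j → j ≢ inj₂ m → ∀ a → + modulus j * a ≡ 0ℤ mod μ m →
                             GeneratedTransvection (inj₂ m) (λ x → a * coord j x)
  torsion-row-transvection m (inj₁ l) _    a _ = scaled-transvection (β-transvection m l) a
  torsion-row-transvection m (inj₂ p) p≢m a μₚa≡0 with Fin.<-cmp p m
  ... | tri< p<m _ _ = scaled-transvection (γ-transvection p<m) a
  ... | tri≈ _ p≡m _ = ⊥-elim (p≢m (cong inj₂ p≡m))
  ... | tri> _ _ m<p = δ-multiple-transvection m<p μₚ∣μₘ (quotient∣ μₚ∣μₘ μₚa≡0)
    where μₚ∣μₘ = μ-chain m p (ℕ.<⇒≤ m<p)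

  torsion-column-generated : ∀ m j → j ≢ inj₂ m → ∀ a → + μ m * a ≡ 0ℤ mod modulus j →
                             IsGenerated (rowOp j 1ℤ (λ x → a * coord (inj₂ m) x))
  torsion-column-generated m (inj₁ l) _ a μₘa≡0 = generated-ext idG λ x →
    ≋-sym (≋-trans (rowOp-ext (inj₁ l) 1ℤ _ (λ _ → 0ℤ) ≡-mod-refl
                              (λ y → ≡⇒≡-mod (trans (cong (_* coord (inj₂ m) y) a≡0) (ℤ.*-zeroˡ (coord (inj₂ m) y)))) x)
                   (rowOp-id (inj₁ l) x))
    where
    a≡0 : a ≡ 0ℤ
    a≡0 = ℤ.*-cancelˡ-≡ (+ μ m) a 0ℤ {{μ-nonZero m}} (trans (mod-0⇒≡ μₘa≡0) (sym (ℤ.*-zeroʳ (+ μ m))))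
  torsion-column-generated m (inj₂ p) p≢m a μₘa≡0 with Fin.<-cmp p m
  ... | tri< p<m _ _ = GeneratedTransvection.generated (δ-multiple-transvection p<m μₘ∣μₚ (quotient∣ μₘ∣μₚ μₘa≡0))
    where μₘ∣μₚ = μ-chain p m (ℕ.<⇒≤ p<m)
  ... | tri≈ _ p≡m _ = ⊥-elim (p≢m (cong inj₂ p≡m))
  ... | tri> _ _ m<p = transvection-powers (γ-transvection m<p) a

  module TorsionStep (m : Fin r) (next : FixingBelow⇒Generated (suc (k ℕ.+ toℕ m))) where

    c₀ : Coord
    c₀ = inj₂ m

    module _ {F} (F-aut : IsAutomorphism F) (F-fixes : FixesBelow F (k ℕ.+ toℕ m)) where
      open IsAutomorphism F-aut

      v : 𝔾
      v = F (basis c₀)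

      y : Coord → ℤ
      y j = coord c₀ (inverse (basis j))

      ỹ : Coord → ℤ
      ỹ j with j ≟ c₀
      ... | yes _ = 0ℤ
      ... | no  _ = y j

      ỹ-pivot : ỹ c₀ ≡ 0ℤ
      ỹ-pivot with c₀ ≟ c₀
      ... | yes _    = refl
      ... | no c₀≢c₀ = ⊥-elim (c₀≢c₀ refl)

      ỹ-off : ∀ {j} → j ≢ c₀ → ỹ j ≡ y j
      ỹ-off {j} j≢c₀ with j ≟ c₀
      ... | yes j≡c₀ = ⊥-elim (j≢c₀ j≡c₀)
      ... | no  _    = refl

      L : 𝔾 → ℤ
      L x = ∑ℤ (λ j → ỹ j * coord j x)

      y-torsion : ∀ j → + modulus j * y j ≡ 0ℤ mod μ m
      y-torsion (inj₁ l) = ≡⇒≡-mod (ℤ.*-zeroˡ (y (inj₁ l)))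
      y-torsion (inj₂ p) = coord-torsion (μ p) (hom-torsion (IsAutomorphism.isHom (inverse-isAutomorphism F-aut)) p) c₀

      L-transvection : GeneratedTransvection c₀ L
      L-transvection = ∑-transvection ℓ-transvection
        where
        ℓ-transvection : ∀ j → GeneratedTransvection c₀ (λ x → ỹ j * coord j x)
        ℓ-transvection j with j ≟ c₀
        ... | yes refl = transvection-≗ (λ x → sym (ℤ.*-zeroˡ (coord c₀ x))) zero-transvection
        ... | no j≢c₀  = torsion-row-transvection m j j≢c₀ (y j) (y-torsion j)

      L-below : ∀ j → position j ℕ.< k ℕ.+ toℕ m → L (basis j) ≡ 0ℤ mod μ m
      L-below j j<c₀ = begin
        L (basis j)                      ≈⟨ ∑ℤ-single (λ j′ → ỹ j′ * coord j′ (basis j)) j off-j ⟩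
        ỹ j * coord j (basis j)          ≡⟨ cong₂ _*_ (ỹ-off (below⇒≢ j<c₀)) (coord-basis-same j) ⟩
        y j * 1ℤ                         ≡⟨ ℤ.*-identityʳ (y j) ⟩
        y j                              ≈⟨ at (inverse-fixesBelow F-aut F-fixes j j<c₀) c₀ ⟩
        coord c₀ (basis j)               ≡⟨ coord-basis-other {j} {c₀} (below⇒≢ j<c₀ ∘ sym) ⟩
        0ℤ                               ∎
        where
        open SetoidReasoning (≡-mod-setoid (μ m))
        off-j : ∀ j′ → j′ ≢ j → ỹ j′ * coord j′ (basis j) ≡ 0ℤ mod μ m
        off-j j′ j′≢j = ≡⇒≡-mod (trans (cong (ỹ j′ *_) (coord-basis-other j′≢j)) (ℤ.*-zeroʳ (ỹ j′)))

      pivot-unimodular : coord c₀ v * y c₀ + L v * 1ℤ ≡ 1ℤ mod μ m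
      pivot-unimodular = ≡-mod-sym (begin
        1ℤ                                                    ≈⟨ pivot-identity F-aut c₀ ⟩
        ∑ℤ (λ j → coord j v * y j)                            ≈⟨ ∑ℤ-split _ (λ j → ỹ j * coord j v) c₀ off-pivot ⟩
        (coord c₀ v * y c₀ - ỹ c₀ * coord c₀ v) + L v
          ≡⟨ cong (λ a → coord c₀ v * y c₀ - a * coord c₀ v + L v) ỹ-pivot ⟩
        (coord c₀ v * y c₀ - 0ℤ * coord c₀ v) + L v           ≡⟨ tidy (coord c₀ v * y c₀) (coord c₀ v) (L v) ⟩
        coord c₀ v * y c₀ + L v * 1ℤ                          ∎)
        where
        open SetoidReasoning (≡-mod-setoid (μ m))
        off-pivot : ∀ j → j ≢ c₀ → coord j v * y j ≡ ỹ j * coord j v mod μ m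
        off-pivot j j≢c₀ = ≡⇒≡-mod (trans (ℤ.*-comm (coord j v) (y j)) (cong (_* coord j v) (sym (ỹ-off j≢c₀))))
        tidy : ∀ a b l → a - 0ℤ * b + l ≡ a + l * 1ℤ
        tidy = solve-∀

      torsion-step : IsGenerated F
      torsion-step =
        reduce-by {T} T-generated T-fixes F-aut F-fixes λ TF-aut TF-fixes →
        reduce-by {S} S-generated S-fixes TF-aut TF-fixes λ STF-aut STF-fixes →
        finish-column c₀ next STF-aut STF-fixes pivot≡1 (torsion STF-aut) λ j j≢c₀ →
          torsion-column-generated m j j≢c₀ _ (negate (torsion STF-aut j))
        where
        shift = stableRange (ℕ.≢-nonZero⁻¹ (μ m) {{μ-nonZero m}}) (coord c₀ v) (L v) (y c₀) 1ℤ pivot-unimodular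
        c = proj₁ shift
        u = proj₁ (proj₂ shift)
        T : 𝔾 → 𝔾
        T = rowOp c₀ 1ℤ (λ x → c * L x)
        T-generated : IsGenerated T
        T-generated = transvection-powers L-transvection c
        T-fixes : ∀ j → position j ℕ.< k ℕ.+ toℕ m → T (basis j) ≋ basis j
        T-fixes j j<c₀ = rowOp-fix c₀ 1ℤ (λ x → c * L x) (coord-basis-other {j} {c₀} (below⇒≢ j<c₀ ∘ sym))
                           (≡-mod-trans (*-congˡ-mod c (L-below j j<c₀)) (≡⇒≡-mod (ℤ.*-zeroʳ c)))
        w : ℤ
        w = 1ℤ * coord c₀ v + c * L v
        uw≡1 : u * w ≡ 1ℤ mod μ m
        uw≡1 = subst (_≡ 1ℤ mod μ m)
                     (trans (ℤ.*-comm _ u) (cong (λ a → u * (a + c * L v)) (sym (ℤ.*-identityˡ (coord c₀ v)))))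
                     (proj₂ (proj₂ shift))
        S : 𝔾 → 𝔾
        S = rowOp c₀ u (λ _ → 0ℤ)
        S-generated : IsGenerated S
        S-generated = generated-ext (gen (ψu m u u-unit)) (ψu-act m u u-unit)
          where u-unit = w , ≡-mod⇒∣ᵘ uw≡1
        S-fixes : ∀ j → position j ℕ.< k ℕ.+ toℕ m → S (basis j) ≋ basis j
        S-fixes j j<c₀ = rowOp-fix c₀ u (λ _ → 0ℤ) (coord-basis-other {j} {c₀} (below⇒≢ j<c₀ ∘ sym)) ≡-mod-refl
        pivot≡1 : coord c₀ (S (T v)) ≡ 1ℤ mod μ m
        pivot≡1 = subst (_≡ 1ℤ mod μ m)
                        (sym (trans (coord-≔-same c₀ (T v) _) (trans (ℤ.+-identityʳ _) (cong (u *_) (coord-≔-same c₀ v _)))))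
                        uw≡1
        torsion : ∀ {G} → IsAutomorphism G → ∀ j → + μ m * coord j (G (basis c₀)) ≡ 0ℤ mod modulus j
        torsion G-aut = coord-torsion (μ m) (hom-torsion (IsAutomorphism.isHom G-aut) m)
        negate : ∀ {n a} → + μ m * a ≡ 0ℤ mod n → + μ m * - a ≡ 0ℤ mod n
        negate {n} {a} μa≡0 = subst₂ (_≡_mod n) (ℤ.neg-distribʳ-* (+ μ m) a) refl (-‿cong-mod μa≡0)

  position<k+r : ∀ j → position j ℕ.< k ℕ.+ r
  position<k+r (inj₁ l) = ℕ.<-≤-trans (Fin.toℕ<n l) (ℕ.m≤m+n k r)
  position<k+r (inj₂ i) = ℕ.+-monoʳ-< k (Fin.toℕ<n i)

  all-fixed : FixingBelow⇒Generated (k ℕ.+ r)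
  all-fixed F-aut F-fixes =
    generated-ext idG (λ x → ≋-sym (hom-fixing-basis (IsAutomorphism.isHom F-aut) (λ j → F-fixes j (position<k+r j)) x))

  fixing-step : ∀ c → FixingBelow⇒Generated (suc (position c)) → FixingBelow⇒Generated (position c)
  fixing-step (inj₁ m)      = FreeStep.free-step m
  fixing-step (inj₂ m) next = TorsionStep.torsion-step m next

  automorphisms-generated : FixingBelow⇒Generated 0
  automorphisms-generated = downward-induction FixingBelow⇒Generated (k ℕ.+ r) all-fixed λ p next →
    subst FixingBelow⇒Generated (position-splitAt p)
          (fixing-step (Fin.splitAt k p) (subst (FixingBelow⇒Generated ∘ suc) (sym (position-splitAt p)) next))

theorem2p1 : (k r : ℕ) (μ : Fin r → ℕ)
    → (∀ i → NonZero (μ i))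
    → (∀ (i j : Fin r) → i ≤ j → μ j ∣ μ i)
    → (f : G k r μ → G k r μ) → IsAut k r μ f → Generated k r μ f
theorem2p1 k r μ μ-nonZero μ-chain f f-aut =
  automorphisms-generated (IsAut⇒IsAutomorphism f-aut) (λ _ ())
  where
  open Group k r μ
  open Generation k r μ μ-nonZero μ-chain
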